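{- For every $g\ge 4$ there exist happy undirected temporal graphs that are temporally connected and whose underlying graph has girth at least $g$.
   Context: An undirected temporal graph is a pair $(G,\lambda)$ with $G$ a finite undirected graph (the underlying graph) and $\lambda$ assigning each edge a nonempty set of positive integer labels. It is happy if each edge has exactly one label and edges sharing an endpoint have different labels. A temporal path is a path of $G$ whose edge labels are nondecreasing along the path (equivalently increasing, in happy graphs). The graph is temporally connected if every ordered pair of distinct vertices is joined by a temporal path. -}

module Defs where

open import Data.Nat using (ℕ; suc; _≤_; _<_)
open import Data.Fin using (Fin)
open import Data.Bool using (Bool; true; false)
open import Data.List using (List; []; _∷_; length)
open import Data.List.Relation.Unary.Unique.Propositional using (Unique)
open import Data.Product using (Σ; _×_; ∃-syntax)
open import Relation.Binary.PropositionalEquality using (_≡_; _≢_)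

record Graph : Set where
  field
    n      : ℕ
    adj    : Fin n → Fin n → Bool
    adj-sym    : ∀ u v → adj u v ≡ adj v u
    adj-irrefl : ∀ u → adj u u ≡ false

open Graph public

Adj : (G : Graph) → Fin (n G) → Fin (n G) → Set
Adj G u v = adj G u v ≡ true

record TemporalGraph : Set₁ where
  field
    G       : Graph
    labels  : Fin (n G) → Fin (n G) → ℕ → Set
    labels-sym      : ∀ u v t → labels u v t → labels v u t
    labels-edge     : ∀ u v t → labels u v t → Adj G u v
    labels-pos      : ∀ u v t → labels u v t → 1 ≤ t
    labels-nonempty : ∀ u v → Adj G u v → ∃[ t ] labels u v t

open TemporalGraph public

Happy : TemporalGraph → Set
Happy T =
  (∀ u v → Adj (G T) u v → ∀ s t → labels T u v s → labels T u v t → s ≡ t)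
  × (∀ u v w → Adj (G T) u v → Adj (G T) u w → v ≢ w →
       ∀ s t → labels T u v s → labels T u w t → s ≢ t)

data Walk (G : Graph) : Fin (n G) → Fin (n G) → List (Fin (n G)) → Set where
  here : ∀ {u} → Walk G u u (u ∷ [])
  next : ∀ {u w v vs} → Adj G u w → Walk G w v vs → Walk G u v (u ∷ vs)

-- Temporal walks: the labels along the walk are nondecreasing; the index m
-- is a lower bound on the label of the first edge.
data TWalk (T : TemporalGraph) : ℕ → Fin (n (G T)) → Fin (n (G T)) → List (Fin (n (G T))) → Set where
  here : ∀ {m u} → TWalk T m u u (u ∷ [])
  next : ∀ {m u w v vs} t → m ≤ t → labels T u w t → TWalk T t w v vs →
         TWalk T m u v (u ∷ vs)

TemporalPath : (T : TemporalGraph) → Fin (n (G T)) → Fin (n (G T)) → Set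
TemporalPath T u v = ∃[ vs ] (TWalk T 0 u v vs × Unique vs)

TemporallyConnected : TemporalGraph → Set
TemporallyConnected T = ∀ u v → u ≢ v → TemporalPath T u v

IsCycle : (G : Graph) → List (Fin (n G)) → Set
IsCycle G vs = ∃[ u ] ∃[ v ] (Walk G u v vs × Adj G v u × Unique vs × 3 ≤ length vs)

HasCycle : Graph → Set
HasCycle G = ∃[ vs ] IsCycle G vs

-- girth(G) ≥ g, with the convention that girth is the length of a shortest
-- cycle; we require G to contain a cycle.
GirthAtLeast : Graph → ℕ → Set
GirthAtLeast G g = HasCycle G × (∀ vs → IsCycle G vs → g ≤ length vs)

{-# OPTIONS --safe #-}
module Submission where

-- Suppose a graph contains two edge-disjoint spanning trees T₁, T₂ with a common root r.
-- Label the T₁-edges increasingly towards r, the T₂-edges increasingly away from r and above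
-- all T₁-labels, and the remaining edges above both, distinctly at each vertex.  This is happy,
-- and u → r along T₁ followed by r → v along T₂ is a temporal walk, which shortcuts to a
-- temporal path.
--
-- For the graph take the Cayley graph of SL₂(ℤ/p), p a large prime, with respect to
-- A = [[1,16],[0,1]], B = [[1,0],[16,1]], their conjugates C, D by [[1,-1],[1,1]], and
-- inverses.  Both {A, B} and {C, D} generate SL₂(ℤ/p) in a bounded number of steps (Bruhat
-- decomposition), so breadth-first search yields the two trees.  A cycle of length ℓ gives a
-- reduced word of length ℓ that is the identity mod p.  By ping-pong on four disjoint cones,
-- such a word moves (2,1) over ℤ, while its entries stay below 2·17^ℓ; so ℓ ≥ g once
-- p > 2·17^g + 2.  The same fact keeps the two trees edge-disjoint and the graph simple.

open import Data.Nat using (ℕ; _≤_; NonZero)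
import Data.Nat as ℕ
import Data.Nat.Properties as ℕ
open import Data.Nat.Primality using (Prime; prime⇒nonZero)
open import Data.Product using (_×_; _,_; ∃-syntax)
open import Defs

module TemporalLabelling where
  open import Data.Nat using (ℕ; zero; suc; _+_; _*_; _∸_; _≤_; _<_; z≤n; s≤s)
  open import Data.Nat.Properties
  open import Data.Fin using (Fin; toℕ) renaming (_≟_ to _≟ᶠ_)
  open import Data.Fin.Properties using (toℕ<n; toℕ-injective; any?)
  open import Data.List using ([]; _∷_)
  open import Data.List.Membership.Propositional using (_∈_)
  open import Data.List.Relation.Unary.Any using (here; there)
  open import Data.List.Relation.Unary.All using ([]; _∷_)
  open import Data.List.Relation.Unary.All.Properties using (¬Any⇒All¬)
  open import Data.List.Relation.Unary.AllPairs using ([]; _∷_)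
  open import Data.List.Relation.Unary.Unique.Propositional using (Unique)
  open import Data.Product using (_,_; proj₁; proj₂; swap)
  open import Data.Sum using (_⊎_; inj₁; inj₂)
  import Data.Sum
  open import Function using (_∘_; id; case_of_)
  open import Relation.Nullary using (¬_; ¬?; Dec; yes; no; contradiction)
  open import Relation.Nullary.Decidable using (_×-dec_; _⊎-dec_)
  open import Relation.Unary using (Decidable)
  open import Relation.Binary.PropositionalEquality
  open import Relation.Binary.Definitions using (tri<; tri≈; tri>)

  lex-< : ∀ {N i j a b} → i < N → a < b → i + N * a < j + N * b
  lex-< {N} {i} {j} {a} {b} i<N a<b = begin-strict
    i + N * a  <⟨ +-monoˡ-< (N * a) i<N ⟩
    N + N * a  ≡⟨ *-suc N a ⟨
    N * suc a  ≤⟨ *-monoʳ-≤ N a<b ⟩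
    N * b      ≤⟨ m≤n+m (N * b) j ⟩
    j + N * b  ∎
    where open ≤-Reasoning

  lex-injective : ∀ {N i j a b} → i < N → j < N → i + N * a ≡ j + N * b → i ≡ j
  lex-injective {a = a} {b} i<N j<N e with <-cmp a b
  ... | tri< a<b _ _ = contradiction e (<⇒≢ (lex-< i<N a<b))
  ... | tri> _ _ b<a = contradiction e (>⇒≢ (lex-< j<N b<a))
  ... | tri≈ _ refl _ = +-cancelʳ-≡ _ _ _ e

  least : ∀ {P : ℕ → Set} → Decidable P → ∀ {k} → P k → ∃[ m ] (P m × ∀ {j} → P j → m ≤ j)
  least {P} P? {k} = search 0 k (λ ())
    where
    search : ∀ i f → (∀ {j} → j < i → ¬ P j) → P (i + f) → ∃[ m ] (P m × ∀ {j} → P j → m ≤ j)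
    search i f below p with P? i
    ... | yes pᵢ = i , pᵢ , λ pⱼ → ≮⇒≥ (λ j<i → below j<i pⱼ)
    search i zero    below p | no ¬pᵢ = contradiction (subst P (+-identityʳ i) p) ¬pᵢ
    search i (suc f) below p | no ¬pᵢ = search (suc i) f below′ (subst P (+-suc i f) p)
      where
      below′ : ∀ {j} → j < suc i → ¬ P j
      below′ j<1+i with m<1+n⇒m<n∨m≡n j<1+i
      ... | inj₁ j<i  = below j<i
      ... | inj₂ refl = ¬pᵢ

  module _ (T : TemporalGraph) where
    open import Data.List.Membership.DecPropositional (_≟ᶠ_ {n (G T)}) using (_∈?_)

    TWalk-weaken : ∀ {m m′ u v vs} → m ≤ m′ → TWalk T m′ u v vs → TWalk T m u v vs
    TWalk-weaken m≤m′ here                = here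
    TWalk-weaken m≤m′ (next t m′≤t ℓ walk) = next t (≤-trans m≤m′ m′≤t) ℓ walk

    TWalk-suffix : ∀ {m u v vs x} → TWalk T m u v vs → Unique vs → x ∈ vs →
                   ∃[ m′ ] (m ≤ m′ × ∃[ ws ] (TWalk T m′ x v ws × Unique ws))
    TWalk-suffix here uniq (here refl) = _ , ≤-refl , _ , here , uniq
    TWalk-suffix here _ (there ())
    TWalk-suffix walk@(next _ _ _ _) uniq (here refl) = _ , ≤-refl , _ , walk , uniq
    TWalk-suffix (next t m≤t _ walk) (_ ∷ uniq) (there x∈) with TWalk-suffix walk uniq x∈
    ... | m′ , t≤m′ , ws , walk′ , uniq′ = m′ , ≤-trans m≤t t≤m′ , ws , walk′ , uniq′

    TWalk⇒path : ∀ {m u v vs} → TWalk T m u v vs → ∃[ ws ] (TWalk T m u v ws × Unique ws)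
    TWalk⇒path {u = u} here = u ∷ [] , here , [] ∷ []
    TWalk⇒path {u = u} (next t m≤t ℓ walk) with TWalk⇒path walk
    ... | ws , walk′ , uniq with u ∈? ws
    ...   | no u∉ws = u ∷ ws , next t m≤t ℓ walk′ , ¬Any⇒All¬ ws u∉ws ∷ uniq
    ...   | yes u∈ws with TWalk-suffix walk′ uniq u∈ws
    ...     | _ , t≤m′ , ys , walk″ , uniq′ = ys , TWalk-weaken (≤-trans m≤t t≤m′) walk″ , uniq′

  _≐_ : ∀ {A : Set} → A × A → A × A → Set
  e ≐ e′ = e ≡ e′ ⊎ swap e ≡ e′

  ≐-sym : ∀ {A : Set} {e e′ : A × A} → e ≐ e′ → e′ ≐ e
  ≐-sym (inj₁ refl) = inj₁ refl
  ≐-sym (inj₂ refl) = inj₂ refl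

  ≐-trans : ∀ {A : Set} {e e′ e″ : A × A} → e ≐ e′ → e′ ≐ e″ → e ≐ e″
  ≐-trans (inj₁ refl) e′≐e″ = e′≐e″
  ≐-trans (inj₂ refl) (inj₁ refl) = inj₂ refl
  ≐-trans (inj₂ refl) (inj₂ refl) = inj₁ refl

  ≐-cancelˡ : ∀ {A : Set} {u v w : A} → (u , v) ≐ (u , w) → u ≢ v → v ≡ w
  ≐-cancelˡ (inj₁ refl) _   = refl
  ≐-cancelˡ (inj₂ refl) u≢v = contradiction refl u≢v

  record SpanningTree {N : ℕ} (E : Fin N → Fin N → Set) (r : Fin N) (H : ℕ) : Set where
    field
      parent       : Fin N → Fin N
      depth        : Fin N → ℕ
      depth≤       : ∀ v → depth v ≤ H
      parent-edge  : ∀ v → v ≢ r → E v (parent v)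
      parent-depth : ∀ v → v ≢ r → depth (parent v) < depth v

    TreeEdge : Fin N → Fin N → Set
    TreeEdge u v = u ≢ r × parent u ≡ v

    InTree : Fin N → Fin N → Set
    InTree u v = TreeEdge u v ⊎ TreeEdge v u

    inTree? : ∀ u v → Dec (InTree u v)
    inTree? u v = edge? u v ⊎-dec edge? v u
      where
      edge? : ∀ u v → Dec (TreeEdge u v)
      edge? u v = ¬? (u ≟ᶠ r) ×-dec (parent u ≟ᶠ v)

    InTree-≐ : ∀ {u v x y} → (u , v) ≐ (x , y) → InTree x y → InTree u v
    InTree-≐ (inj₁ refl) = id
    InTree-≐ (inj₂ refl) = Data.Sum.swap

    TreeEdge-asym : ∀ {u v} → TreeEdge u v → ¬ TreeEdge v u
    TreeEdge-asym {u} (u≢r , refl) (pu≢r , ppu≡u) =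
      <-asym (parent-depth u u≢r) (subst (λ w → depth w < depth (parent u)) ppu≡u (parent-depth (parent u) pu≢r))

    TreeEdge-≐ : ∀ {u v x y} → TreeEdge u v → TreeEdge x y → (u , v) ≐ (x , y) → u ≡ x
    TreeEdge-≐ _ _ (inj₁ refl) = refl
    TreeEdge-≐ uv vu (inj₂ refl) = contradiction vu (TreeEdge-asym uv)

  SpanningTree-map : ∀ {N} {E E′ : Fin N → Fin N → Set} {r H} →
                     (∀ {u v} → E u v → E′ u v) → SpanningTree E r H → SpanningTree E′ r H
  SpanningTree-map E⊆E′ T = record
    { parent = parent ; depth = depth ; depth≤ = depth≤
    ; parent-edge = λ v v≢r → E⊆E′ (parent-edge v v≢r) ; parent-depth = parent-depth }
    where open SpanningTree T

  module TwoTreeLabelling (Γ : Graph) (r : Fin (n Γ)) (H : ℕ) (T₁ T₂ : SpanningTree (Adj Γ) r H)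
    (disjoint : ∀ {u v} → SpanningTree.InTree T₁ u v → ¬ SpanningTree.InTree T₂ u v) where

    private
      N = n Γ
      module T₁ = SpanningTree T₁
      module T₂ = SpanningTree T₂

    data Code : Set where
      tree₁ tree₂ : Fin N → Code
      cross       : Fin N → Fin N → Code

    ends : Code → Fin N × Fin N
    ends (tree₁ x)   = x , T₁.parent x
    ends (tree₂ x)   = x , T₂.parent x
    ends (cross x y) = x , y

    Valid : Code → Set
    Valid (tree₁ x)   = x ≢ r
    Valid (tree₂ x)   = x ≢ r
    Valid (cross x y) = ¬ T₁.InTree x y × ¬ T₂.InTree x y

    Codes : Code → Fin N → Fin N → Set
    Codes c u v = Valid c × (u , v) ≐ ends c

    -- Labels are two-digit numbers in base N: tree₁ labels fall with depth, tree₂ labels rise with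
    -- depth above every tree₁ label, and cross labels lie above both, distinct at each vertex
    -- because x + y determines y from x.
    ⌜_⌝ : Code → ℕ
    ⌜ tree₁ x ⌝   = suc (toℕ x + N * (H ∸ T₁.depth x))
    ⌜ tree₂ x ⌝   = suc (toℕ x + N * (suc H + T₂.depth x))
    ⌜ cross x y ⌝ = suc (toℕ x + toℕ y + N * (2 * suc H))

    classify : ∀ u v → ∃[ c ] Codes c u v
    classify u v with T₁.inTree? u v | T₂.inTree? u v
    ... | yes (inj₁ (u≢r , refl)) | _ = tree₁ u , u≢r , inj₁ refl
    ... | yes (inj₂ (v≢r , refl)) | _ = tree₁ v , v≢r , inj₂ refl
    ... | no _ | yes (inj₁ (u≢r , refl)) = tree₂ u , u≢r , inj₁ refl
    ... | no _ | yes (inj₂ (v≢r , refl)) = tree₂ v , v≢r , inj₂ refl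
    ... | no ¬t₁ | no ¬t₂ = cross u v , (¬t₁ , ¬t₂) , inj₁ refl

    tree₁-in : ∀ {x u v} → Codes (tree₁ x) u v → T₁.InTree u v
    tree₁-in (x≢r , uv) = T₁.InTree-≐ uv (inj₁ (x≢r , refl))

    tree₂-in : ∀ {x u v} → Codes (tree₂ x) u v → T₂.InTree u v
    tree₂-in (x≢r , uv) = T₂.InTree-≐ uv (inj₁ (x≢r , refl))

    cross-out : ∀ {x y u v} → Codes (cross x y) u v → ¬ T₁.InTree u v × ¬ T₂.InTree u v
    cross-out ((¬t₁ , ¬t₂) , uv) = ¬t₁ ∘ T₁.InTree-≐ (≐-sym uv) , ¬t₂ ∘ T₂.InTree-≐ (≐-sym uv)

    cross-sum : ∀ {x y u v : Fin N} → (u , v) ≐ (x , y) → toℕ u + toℕ v ≡ toℕ x + toℕ y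
    cross-sum (inj₁ refl) = refl
    cross-sum {u = u} {v} (inj₂ refl) = +-comm (toℕ u) (toℕ v)

    code-unique : ∀ {c c′ u v} → Codes c u v → Codes c′ u v → ⌜ c ⌝ ≡ ⌜ c′ ⌝
    code-unique {tree₁ x} {tree₁ y} (x≢r , ux) (y≢r , uy) =
      cong (⌜_⌝ ∘ tree₁) (T₁.TreeEdge-≐ (x≢r , refl) (y≢r , refl) (≐-trans (≐-sym ux) uy))
    code-unique {tree₂ x} {tree₂ y} (x≢r , ux) (y≢r , uy) =
      cong (⌜_⌝ ∘ tree₂) (T₂.TreeEdge-≐ (x≢r , refl) (y≢r , refl) (≐-trans (≐-sym ux) uy))
    code-unique {cross x y} {cross x′ y′} (_ , ux) (_ , ux′) =
      cong (λ s → suc (s + N * (2 * suc H))) (trans (sym (cross-sum ux)) (cross-sum ux′))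
    code-unique {tree₁ _} {tree₂ _} c c′ = contradiction (tree₂-in c′) (disjoint (tree₁-in c))
    code-unique {tree₂ _} {tree₁ _} c c′ = contradiction (tree₂-in c) (disjoint (tree₁-in c′))
    code-unique {tree₁ _} {cross _ _} c c′ = contradiction (tree₁-in c) (proj₁ (cross-out c′))
    code-unique {cross _ _} {tree₁ _} c c′ = contradiction (tree₁-in c′) (proj₁ (cross-out c))
    code-unique {tree₂ _} {cross _ _} c c′ = contradiction (tree₂-in c) (proj₂ (cross-out c′))
    code-unique {cross _ _} {tree₂ _} c c′ = contradiction (tree₂-in c′) (proj₂ (cross-out c))

    tree₁<tree₂ : ∀ x y → ⌜ tree₁ x ⌝ < ⌜ tree₂ y ⌝
    tree₁<tree₂ x y = s≤s (lex-< (toℕ<n x) (s≤s (≤-trans (m∸n≤m H (T₁.depth x)) (m≤m+n H (T₂.depth y)))))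

    tree₁<cross : ∀ x y z → ⌜ tree₁ x ⌝ < ⌜ cross y z ⌝
    tree₁<cross x y z = s≤s (lex-< (toℕ<n x) (≤-trans (s≤s (m∸n≤m H (T₁.depth x))) (m≤m+n (suc H) (suc H + 0))))

    tree₂<cross : ∀ x y z → ⌜ tree₂ x ⌝ < ⌜ cross y z ⌝
    tree₂<cross x y z =
      s≤s (lex-< (toℕ<n x) (+-monoʳ-< (suc H) (s≤s (≤-trans (T₂.depth≤ x) (m≤m+n H 0)))))

    code-local-injective : ∀ {c c′ u v w} → Codes c u v → Codes c′ u w → ⌜ c ⌝ ≡ ⌜ c′ ⌝ → u ≢ v → v ≡ w
    code-local-injective {tree₁ x} {tree₁ y} (_ , ux) (_ , uy) e u≢v
      with toℕ-injective (lex-injective (toℕ<n x) (toℕ<n y) (suc-injective e))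
    ... | refl = ≐-cancelˡ (≐-trans ux (≐-sym uy)) u≢v
    code-local-injective {tree₂ x} {tree₂ y} (_ , ux) (_ , uy) e u≢v
      with toℕ-injective (lex-injective (toℕ<n x) (toℕ<n y) (suc-injective e))
    ... | refl = ≐-cancelˡ (≐-trans ux (≐-sym uy)) u≢v
    code-local-injective {cross x y} {cross x′ y′} {u} (_ , ux) (_ , ux′) e _ =
      toℕ-injective (+-cancelˡ-≡ (toℕ u) _ _ (begin
        toℕ u + toℕ _ ≡⟨ cross-sum ux ⟩
        toℕ x + toℕ y ≡⟨ +-cancelʳ-≡ (N * (2 * suc H)) _ _ (suc-injective e) ⟩
        toℕ x′ + toℕ y′ ≡⟨ cross-sum ux′ ⟨
        toℕ u + toℕ _ ∎))
      where open ≡-Reasoning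
    code-local-injective {tree₁ x} {tree₂ y} _ _ e = contradiction e (<⇒≢ (tree₁<tree₂ x y))
    code-local-injective {tree₂ x} {tree₁ y} _ _ e = contradiction e (>⇒≢ (tree₁<tree₂ y x))
    code-local-injective {tree₁ x} {cross y z} _ _ e = contradiction e (<⇒≢ (tree₁<cross x y z))
    code-local-injective {cross y z} {tree₁ x} _ _ e = contradiction e (>⇒≢ (tree₁<cross x y z))
    code-local-injective {tree₂ x} {cross y z} _ _ e = contradiction e (<⇒≢ (tree₂<cross x y z))
    code-local-injective {cross y z} {tree₂ x} _ _ e = contradiction e (>⇒≢ (tree₂<cross x y z))

    Labels : Fin N → Fin N → ℕ → Set
    Labels u v t = Adj Γ u v × ∃[ c ] (Codes c u v × ⌜ c ⌝ ≡ t)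

    temporalGraph : TemporalGraph
    temporalGraph = record
      { G               = Γ
      ; labels          = Labels
      ; labels-sym      = λ { u v t (uv , c , (valid , e) , refl) →
                            trans (adj-sym Γ v u) uv , c , (valid , ≐-trans (inj₂ refl) e) , refl }
      ; labels-edge     = λ u v t → proj₁
      ; labels-pos      = λ { u v _ (_ , c , _ , refl) → code-pos c }
      ; labels-nonempty = λ u v uv → let (c , cuv) = classify u v in ⌜ c ⌝ , uv , c , cuv , refl
      }
      where
      code-pos : ∀ c → 1 ≤ ⌜ c ⌝
      code-pos (tree₁ _)   = s≤s z≤n
      code-pos (tree₂ _)   = s≤s z≤n
      code-pos (cross _ _) = s≤s z≤n

    happy : Happy temporalGraph
    happy = (λ { u v _ s t (_ , c , cuv , refl) (_ , c′ , c′uv , refl) → code-unique cuv c′uv })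
          , λ { u v w uv _ v≢w s t (_ , c , cuv , refl) (_ , c′ , c′uw , refl) e →
                  v≢w (code-local-injective cuv c′uw e (λ { refl → no-loop uv })) }
      where
      no-loop : ∀ {u} → ¬ Adj Γ u u
      no-loop {u} uu = case trans (sym uu) (adj-irrefl Γ u) of λ ()

    tree₁-label : ∀ {x} → x ≢ r → Labels x (T₁.parent x) ⌜ tree₁ x ⌝
    tree₁-label {x} x≢r = T₁.parent-edge x x≢r , tree₁ x , (x≢r , inj₁ refl) , refl

    tree₂-label : ∀ {x} → x ≢ r → Labels (T₂.parent x) x ⌜ tree₂ x ⌝
    tree₂-label {x} x≢r =
      trans (adj-sym Γ _ x) (T₂.parent-edge x x≢r) , tree₂ x , (x≢r , inj₂ refl) , refl

    tree₁-code-mono : ∀ {x} → x ≢ r → ⌜ tree₁ x ⌝ ≤ ⌜ tree₁ (T₁.parent x) ⌝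
    tree₁-code-mono {x} x≢r = s≤s (<⇒≤ (lex-< (toℕ<n x) (∸-monoʳ-< (T₁.parent-depth x x≢r) (T₁.depth≤ x))))

    tree₂-code-mono : ∀ {x} → x ≢ r → ⌜ tree₂ (T₂.parent x) ⌝ ≤ ⌜ tree₂ x ⌝
    tree₂-code-mono {x} x≢r =
      s≤s (<⇒≤ (lex-< (toℕ<n (T₂.parent x)) (+-monoʳ-< (suc H) (T₂.parent-depth x x≢r))))

    module _ (y : Fin N) where

      from-root : ∃[ vs ] TWalk temporalGraph ⌜ tree₂ r ⌝ r y vs
      from-root = descend y (s≤s (T₂.depth≤ y)) (y ∷ [] , here)
        where
        descend : ∀ {k} z → T₂.depth z < k → ∃[ vs ] TWalk temporalGraph ⌜ tree₂ z ⌝ z y vs →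
                  ∃[ vs ] TWalk temporalGraph ⌜ tree₂ r ⌝ r y vs
        descend {suc k} z dz walk with z ≟ᶠ r
        ... | yes refl = walk
        ... | no z≢r   = descend (T₂.parent z) (<-≤-trans (T₂.parent-depth z z≢r) (≤-pred dz))
                           (_ , next _ (tree₂-code-mono z≢r) (tree₂-label z≢r) (proj₂ walk))

      via-root : ∀ {k} x → T₁.depth x < k → ∀ {m} → m ≤ ⌜ tree₁ x ⌝ → ∃[ vs ] TWalk temporalGraph m x y vs
      via-root {suc k} x dx m≤ with x ≟ᶠ r
      ... | yes refl = _ , TWalk-weaken temporalGraph (≤-trans m≤ (<⇒≤ (tree₁<tree₂ r r))) (proj₂ from-root)
      ... | no x≢r   = _ , next _ m≤ (tree₁-label x≢r)
                             (proj₂ (via-root (T₁.parent x) (<-≤-trans (T₁.parent-depth x x≢r) (≤-pred dx))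
                                              (tree₁-code-mono x≢r)))

    connected : TemporallyConnected temporalGraph
    connected u v _ = TWalk⇒path temporalGraph (proj₂ (via-root v u (s≤s (T₁.depth≤ u)) z≤n))

  module BreadthFirst {N : ℕ} (E : Fin N → Fin N → Set) (E? : ∀ v w → Dec (E v w)) (r : Fin N) where

    Reach : ℕ → Fin N → Set
    Reach zero    v = v ≡ r
    Reach (suc k) v = Reach k v ⊎ ∃[ w ] (E v w × Reach k w)

    reach? : ∀ k v → Dec (Reach k v)
    reach? zero    v = v ≟ᶠ r
    reach? (suc k) v = reach? k v ⊎-dec any? (λ w → E? v w ×-dec reach? k w)

    Reach-mono : ∀ {k m v} → k ≤ m → Reach k v → Reach m v
    Reach-mono {m = zero}  z≤n       reach = reach
    Reach-mono {m = suc m} z≤n       reach = inj₁ (Reach-mono z≤n reach)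
    Reach-mono             (s≤s k≤m) (inj₁ reach) = inj₁ (Reach-mono k≤m reach)
    Reach-mono             (s≤s k≤m) (inj₂ (w , e , reach)) = inj₂ (w , e , Reach-mono k≤m reach)

    bfsTree : ∀ K → (∀ v → Reach K v) → SpanningTree E r K
    bfsTree K reach = record
      { parent       = parent
      ; depth        = depth
      ; depth≤       = λ v → depth-least v (reach v)
      ; parent-edge  = parent-edge
      ; parent-depth = parent-depth
      }
      where
      minimal : ∀ v → ∃[ d ] (Reach d v × ∀ {k} → Reach k v → d ≤ k)
      minimal v = least (λ k → reach? k v) (reach v)

      depth : Fin N → ℕ
      depth v = proj₁ (minimal v)

      depth-least : ∀ v {k} → Reach k v → depth v ≤ k
      depth-least v = proj₂ (proj₂ (minimal v))

      descend : ∀ v → v ≢ r → ∀ d → Reach d v → (∀ {k} → Reach k v → d ≤ k) →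
                ∃[ w ] (E v w × depth w < d)
      descend v v≢r zero    v≡r                 _   = contradiction v≡r v≢r
      descend v v≢r (suc d) (inj₁ reach)        min = contradiction (min reach) (n≮n d)
      descend v v≢r (suc d) (inj₂ (w , e , rw)) _   = w , e , s≤s (depth-least w rw)

      closer : ∀ v → v ≢ r → ∃[ w ] (E v w × depth w < depth v)
      closer v v≢r = descend v v≢r (depth v) (proj₁ (proj₂ (minimal v))) (depth-least v)

      -- The proofs below split on an explicit Dec argument: `with v ≟ᶠ r` would also abstract the
      -- test hidden inside `depth v`, as Reach 0 v is decided by v ≟ᶠ r.
      parent-or-root : ∀ v → Dec (v ≡ r) → Fin N
      parent-or-root v (yes _)  = v
      parent-or-root v (no v≢r) = proj₁ (closer v v≢r)

      parent : Fin N → Fin N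
      parent v = parent-or-root v (v ≟ᶠ r)

      parent-edge : ∀ v → v ≢ r → E v (parent v)
      parent-edge v v≢r = edge (v ≟ᶠ r)
        where
        edge : (v≟r : Dec (v ≡ r)) → E v (parent-or-root v v≟r)
        edge (yes v≡r) = contradiction v≡r v≢r
        edge (no v≢r′) = proj₁ (proj₂ (closer v v≢r′))

      parent-depth : ∀ v → v ≢ r → depth (parent v) < depth v
      parent-depth v v≢r = descends (v ≟ᶠ r)
        where
        descends : (v≟r : Dec (v ≡ r)) → depth (parent-or-root v v≟r) < depth v
        descends (yes v≡r) = contradiction v≡r v≢r
        descends (no v≢r′) = proj₂ (proj₂ (closer v v≢r′))

module CayleyGraphs where
  open import Data.Nat using (ℕ; zero; suc; _+_; _≤_; _<_; z≤n; s≤s)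
  open import Data.Nat.Properties
  open import Data.Bool using (true)
  open import Data.Fin using (Fin; zero; suc; toℕ; fromℕ; inject₁) renaming (_≟_ to _≟ᶠ_)
  open import Data.Fin.Properties using (toℕ<n; toℕ-injective; toℕ-inject₁; toℕ-fromℕ; pigeonhole)
  open import Data.List using (List; []; _∷_; length; foldl; replicate; tabulate)
  open import Data.List.Properties using (length-replicate; length-tabulate)
  open import Data.List.Membership.Propositional using (_∈_; lose)
  open import Data.List.Relation.Unary.Any using (here; there; satisfied) renaming (any? to anyᴸ?)
  open import Data.List.Relation.Unary.All using (All; []; _∷_)
  import Data.List.Relation.Unary.All as All
  open import Data.List.Relation.Unary.AllPairs using (_∷_)
  open import Data.List.Relation.Unary.Unique.Propositional using (Unique)
  open import Data.List.Relation.Unary.Unique.Propositional.Properties using (tabulate⁺)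
  open import Data.Product using (∃; _,_; proj₁; proj₂)
  open import Data.Sum using (inj₁; inj₂)
  open import Data.Unit using (⊤; tt)
  open import Function using (_∘_; case_of_)
  open import Relation.Nullary using (¬_; Dec; yes; no; does; contradiction)
  open import Relation.Nullary.Decidable using (map′; dec-true; dec-false; _×-dec_)
  open import Relation.Binary.PropositionalEquality
  open import Relation.Binary.Definitions using (tri<; tri≈; tri>)
  open TemporalLabelling

  data Half : Set where
    first second : Half

  data Shape : Set where
    upper lower : Shape

  data Sign : Set where
    pos neg : Sign

  record Letter : Set where
    constructor letter
    field
      half  : Half
      shape : Shape
      sign  : Sign

  open Letter

  infixl 30 _⁻¹
  _⁻¹ : Letter → Letter
  letter h s pos ⁻¹ = letter h s neg
  letter h s neg ⁻¹ = letter h s pos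

  half-⁻¹ : ∀ ℓ → half (ℓ ⁻¹) ≡ half ℓ
  half-⁻¹ (letter _ _ pos) = refl
  half-⁻¹ (letter _ _ neg) = refl

  ⁻¹-≢ : ∀ ℓ → ℓ ≢ ℓ ⁻¹
  ⁻¹-≢ (letter _ _ pos) ()
  ⁻¹-≢ (letter _ _ neg) ()

  _≟ʰ_ : (h h′ : Half) → Dec (h ≡ h′)
  first  ≟ʰ first  = yes refl
  first  ≟ʰ second = no λ ()
  second ≟ʰ first  = no λ ()
  second ≟ʰ second = yes refl

  _≟ˢ_ : (s s′ : Shape) → Dec (s ≡ s′)
  upper ≟ˢ upper = yes refl
  upper ≟ˢ lower = no λ ()
  lower ≟ˢ upper = no λ ()
  lower ≟ˢ lower = yes refl

  letters : List Letter
  letters = letter first upper pos ∷ letter first upper neg ∷ letter first lower pos ∷ letter first lower neg ∷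
            letter second upper pos ∷ letter second upper neg ∷ letter second lower pos ∷ letter second lower neg ∷ []

  ∈-letters : ∀ ℓ → ℓ ∈ letters
  ∈-letters (letter first  upper pos) = here refl
  ∈-letters (letter first  upper neg) = there (here refl)
  ∈-letters (letter first  lower pos) = there (there (here refl))
  ∈-letters (letter first  lower neg) = there (there (there (here refl)))
  ∈-letters (letter second upper pos) = there (there (there (there (here refl))))
  ∈-letters (letter second upper neg) = there (there (there (there (there (here refl)))))
  ∈-letters (letter second lower pos) = there (there (there (there (there (there (here refl))))))
  ∈-letters (letter second lower neg) = there (there (there (there (there (there (there (here refl)))))))

  ∃-letter? : {P : Letter → Set} → (∀ ℓ → Dec (P ℓ)) → Dec (∃ P)
  ∃-letter? P? = map′ satisfied (λ (ℓ , p) → lose (∈-letters ℓ) p) (anyᴸ? P? letters)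

  Word : Set
  Word = List Letter

  Reduced : Word → Set
  Reduced (ℓ ∷ ℓ′ ∷ w) = ℓ′ ≢ ℓ ⁻¹ × Reduced (ℓ′ ∷ w)
  Reduced _            = ⊤

  replicate-reduced : ∀ k ℓ → Reduced (replicate k ℓ)
  replicate-reduced zero          ℓ = tt
  replicate-reduced (suc zero)    ℓ = tt
  replicate-reduced (suc (suc k)) ℓ = ⁻¹-≢ ℓ , replicate-reduced (suc k) ℓ

  module Cayley {N : ℕ} (_·_ : Fin N → Letter → Fin N) (·-⁻¹ : ∀ v ℓ → (v · ℓ) · ℓ ⁻¹ ≡ v)
    (g : ℕ) (3≤g : 3 ≤ g)
    (short-free : ∀ v w → Reduced w → 0 < length w → length w < g → foldl _·_ v w ≢ v) where

    infixl 5 _·ʷ_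
    _·ʷ_ : Fin N → Word → Fin N
    _·ʷ_ = foldl _·_

    ·-injective : ∀ {u v} ℓ → u · ℓ ≡ v · ℓ → u ≡ v
    ·-injective {u} {v} ℓ e = trans (sym (·-⁻¹ u ℓ)) (trans (cong (_· ℓ ⁻¹) e) (·-⁻¹ v ℓ))

    ·-flip : ∀ {u v} ℓ → u · ℓ ≡ v → v · ℓ ⁻¹ ≡ u
    ·-flip {u} ℓ refl = ·-⁻¹ u ℓ

    adjacent? : ∀ u v → Dec (∃[ ℓ ] u · ℓ ≡ v)
    adjacent? u v = ∃-letter? (λ ℓ → u · ℓ ≟ᶠ v)

    graph : Graph
    graph = record
      { n          = N
      ; adj        = λ u v → does (adjacent? u v)
      ; adj-sym    = λ u v → does-≡ (adjacent? u v) (adjacent? v u) flip flip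
      ; adj-irrefl = λ u → dec-false (adjacent? u u) λ (ℓ , uℓ≡u) →
                       short-free u (ℓ ∷ []) tt (s≤s z≤n) (<-≤-trans (s≤s (s≤s z≤n)) 3≤g) uℓ≡u
      }
      where
      flip : ∀ {u v} → ∃[ ℓ ] u · ℓ ≡ v → ∃[ ℓ ] v · ℓ ≡ u
      flip (ℓ , e) = ℓ ⁻¹ , ·-flip ℓ e
      does-≡ : ∀ {A B : Set} (a? : Dec A) (b? : Dec B) → (A → B) → (B → A) → does a? ≡ does b?
      does-≡ (yes a) b? to from = sym (dec-true b? (to a))
      does-≡ (no ¬a) b? to from = sym (dec-false b? (¬a ∘ from))

    adj⇒letter : ∀ {u v} → Adj graph u v → ∃[ ℓ ] u · ℓ ≡ v
    adj⇒letter {u} {v} = witness (adjacent? u v)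
      where
      witness : ∀ {A : Set} (a? : Dec A) → does a? ≡ true → A
      witness (yes a) _ = a

    letter⇒adj : ∀ {u v} ℓ → u · ℓ ≡ v → Adj graph u v
    letter⇒adj {u} {v} ℓ e = dec-true (adjacent? u v) (ℓ , e)

    letterOf : ∀ {u v} → Adj graph u v → Letter
    letterOf = proj₁ ∘ adj⇒letter

    wordOf : ∀ {u v vs} → Walk graph u v vs → Word
    wordOf here          = []
    wordOf (next e walk) = letterOf e ∷ wordOf walk

    wordOf-· : ∀ {u v vs} (walk : Walk graph u v vs) → u ·ʷ wordOf walk ≡ v
    wordOf-· here          = refl
    wordOf-· (next e walk) = trans (cong (_·ʷ wordOf walk) (proj₂ (adj⇒letter e))) (wordOf-· walk)

    length-wordOf : ∀ {u v vs} (walk : Walk graph u v vs) → suc (length (wordOf walk)) ≡ length vs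
    length-wordOf here          = refl
    length-wordOf (next _ walk) = cong suc (length-wordOf walk)

    walk-head : ∀ {u v vs} → Walk graph u v vs → u ∈ vs
    walk-head here       = here refl
    walk-head (next _ _) = here refl

    walk-last : ∀ {u v vs} → Walk graph u v vs → v ∈ vs
    walk-last here          = here refl
    walk-last (next _ walk) = there (walk-last walk)

    wordOf-reduced : ∀ {u v vs} (walk : Walk graph u v vs) → Unique vs → Reduced (wordOf walk)
    wordOf-reduced here                 _            = tt
    wordOf-reduced (next _ here)        _            = tt
    wordOf-reduced (next {u} {w} e (next e′ walk)) (u∉ ∷ uniq) =
      no-return , wordOf-reduced (next e′ walk) uniq
      where
      no-return : letterOf e′ ≢ letterOf e ⁻¹
      no-return eq = All.lookup u∉ (there (walk-head walk)) (sym (begin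
        _                           ≡⟨ proj₂ (adj⇒letter e′) ⟨
        w · letterOf e′             ≡⟨ cong (w ·_) eq ⟩
        w · letterOf e ⁻¹           ≡⟨ ·-flip (letterOf e) (proj₂ (adj⇒letter e)) ⟩
        u                           ∎))
        where open ≡-Reasoning

    loop-trivial : ∀ {v vs} → Walk graph v v vs → Unique vs → length vs ≡ 1
    loop-trivial here          _         = refl
    loop-trivial (next _ walk) (v∉ ∷ _) = contradiction refl (All.lookup v∉ (walk-last walk))

    closing-reduced : ∀ {u v vs} ℓ → v · ℓ ≡ u → (walk : Walk graph u v vs) → Unique vs → 3 ≤ length vs →
                      Reduced (ℓ ∷ wordOf walk)
    closing-reduced ℓ _ here _ _ = tt
    closing-reduced {u} {v} ℓ vℓ≡u (next {w = w} e walk) uniq@(_ ∷ uniq′) 3≤len =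
      no-return , wordOf-reduced (next e walk) uniq
      where
      no-return : letterOf e ≢ ℓ ⁻¹
      no-return eq with trans (sym (proj₂ (adj⇒letter e))) (trans (cong (u ·_) eq) (·-flip ℓ vℓ≡u))
      ... | refl = <-irrefl (sym (cong suc (loop-trivial walk uniq′))) 3≤len

    cycle⇒relation : ∀ {vs} → IsCycle graph vs →
                     ∃[ v ] ∃[ w ] (Reduced w × length w ≡ length vs × v ·ʷ w ≡ v)
    cycle⇒relation (u , v , walk , vu , uniq , 3≤len) =
      v , letterOf vu ∷ wordOf walk , closing-reduced (letterOf vu) (proj₂ (adj⇒letter vu)) walk uniq 3≤len ,
      length-wordOf walk , trans (cong (_·ʷ wordOf walk) (proj₂ (adj⇒letter vu))) (wordOf-· walk)

    cycle-length-≥ : ∀ vs → IsCycle graph vs → g ≤ length vs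
    cycle-length-≥ vs cyc@(_ , _ , _ , _ , _ , 3≤len) with cycle⇒relation cyc
    ... | v , w , reduced , len , closes = ≮⇒≥ λ vs<g →
      short-free v w reduced (subst (0 <_) (sym len) (<-≤-trans (s≤s z≤n) 3≤len)) (subst (_< g) (sym len) vs<g) closes

    tabulate-walk : ∀ {k} (f : Fin (suc k) → Fin N) → (∀ i → Adj graph (f (inject₁ i)) (f (suc i))) →
                    Walk graph (f zero) (f (fromℕ k)) (tabulate f)
    tabulate-walk {zero}  f adj = here
    tabulate-walk {suc k} f adj = next (adj zero) (tabulate-walk (f ∘ suc) (adj ∘ suc))

    module Orbit (u : Fin N) (ℓ : Letter) where

      ·ʷ-replicate-suc : ∀ x k → x ·ʷ replicate (suc k) ℓ ≡ (x ·ʷ replicate k ℓ) · ℓ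
      ·ʷ-replicate-suc x zero    = refl
      ·ʷ-replicate-suc x (suc k) = ·ʷ-replicate-suc (x · ℓ) k

      ·ʷ-replicate-+ : ∀ x a b → x ·ʷ replicate (a + b) ℓ ≡ (x ·ʷ replicate a ℓ) ·ʷ replicate b ℓ
      ·ʷ-replicate-+ x zero    b = refl
      ·ʷ-replicate-+ x (suc a) b = ·ʷ-replicate-+ (x · ℓ) a b

      ·ʷ-replicate-injective : ∀ {x y} k → x ·ʷ replicate k ℓ ≡ y ·ʷ replicate k ℓ → x ≡ y
      ·ʷ-replicate-injective zero    e = e
      ·ʷ-replicate-injective (suc k) e = ·-injective ℓ (·ʷ-replicate-injective k e)

      power : ℕ → Fin N
      power k = u ·ʷ replicate k ℓ

      collision⇒return : ∀ {a b} → a < b → power a ≡ power b →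
                         ∃[ d ] (suc d + a ≡ b × power (suc d) ≡ u)
      collision⇒return {a} a<b e with m≤n⇒∃[o]m+o≡n a<b
      ... | d , refl = d , cong suc (+-comm d a) , ·ʷ-replicate-injective a (sym (begin
        u ·ʷ replicate a ℓ                           ≡⟨ e ⟩
        u ·ʷ replicate (suc (a + d)) ℓ               ≡⟨ cong (λ k → u ·ʷ replicate (suc k) ℓ) (+-comm a d) ⟩
        u ·ʷ replicate (suc d + a) ℓ                 ≡⟨ ·ʷ-replicate-+ u (suc d) a ⟩
        power (suc d) ·ʷ replicate a ℓ               ∎))
        where open ≡-Reasoning

      returns : ∃[ d ] power (suc d) ≡ u
      returns with pigeonhole (n<1+n N) (power ∘ toℕ)
      ... | i , j , i<j , e = let (d , _ , ret) = collision⇒return i<j e in d , ret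

      order : ∃[ d ] (power (suc d) ≡ u × ∀ {k} → power (suc k) ≡ u → d ≤ k)
      order = least {λ k → power (suc k) ≡ u} (λ k → power (suc k) ≟ᶠ u) {proj₁ returns} (proj₂ returns)

      private
        d = proj₁ order

      no-early-return : ∀ {a b} → a < b → b < suc d → power a ≢ power b
      no-early-return a<b b<1+d e with collision⇒return a<b e
      ... | k , refl , ret =
        <-irrefl refl (≤-trans (s≤s (proj₂ (proj₂ order) ret)) (≤-trans (m≤m+n (suc k) _) (≤-pred b<1+d)))

      orbit : Fin (suc d) → Fin N
      orbit = power ∘ toℕ

      orbit-injective : ∀ {i j} → orbit i ≡ orbit j → i ≡ j
      orbit-injective {i} {j} e with <-cmp (toℕ i) (toℕ j)
      ... | tri≈ _ i≡j _ = toℕ-injective i≡j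
      ... | tri< i<j _ _ = contradiction e (no-early-return i<j (toℕ<n j))
      ... | tri> _ _ j<i = contradiction (sym e) (no-early-return j<i (toℕ<n i))

      cycle : HasCycle graph
      cycle = tabulate orbit , u , orbit (fromℕ d) , tabulate-walk orbit consecutive , closing ,
              tabulate⁺ orbit-injective , subst (3 ≤_) (sym (length-tabulate orbit)) (≤-trans 3≤g g≤1+d)
        where
        consecutive : ∀ i → Adj graph (orbit (inject₁ i)) (orbit (suc i))
        consecutive i =
          letter⇒adj ℓ (trans (cong (λ k → power k · ℓ) (toℕ-inject₁ i)) (sym (·ʷ-replicate-suc u (toℕ i))))
        closing : Adj graph (orbit (fromℕ d)) u
        closing = letter⇒adj ℓ (trans (cong (λ k → power k · ℓ) (toℕ-fromℕ d))
                                 (trans (sym (·ʷ-replicate-suc u d)) (proj₁ (proj₂ order))))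
        g≤1+d : g ≤ suc d
        g≤1+d = ≮⇒≥ (λ 1+d<g → short-free u (replicate (suc d) ℓ) (replicate-reduced (suc d) ℓ)
                        (subst (0 <_) (sym (length-replicate (suc d))) (s≤s z≤n))
                        (subst (_< g) (sym (length-replicate (suc d))) 1+d<g) (proj₁ (proj₂ order)))

    Step : Half → Fin N → Fin N → Set
    Step h v w = ∃[ ℓ ] (half ℓ ≡ h × v · ℓ ≡ w)

    step? : ∀ h v w → Dec (Step h v w)
    step? h v w = ∃-letter? (λ ℓ → (half ℓ ≟ʰ h) ×-dec (v · ℓ ≟ᶠ w))

    module HalfTrees (r : Fin N) (K : ℕ)
      (spans : ∀ h v → ∃[ w ] (All (λ ℓ → half ℓ ≡ h) w × length w ≤ K × r ·ʷ w ≡ v)) where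

      bfsTree : ∀ h → SpanningTree (Step h) r K
      bfsTree h = BreadthFirst.bfsTree (Step h) (step? h) r K reach
        where
        open BreadthFirst (Step h) (step? h) r using (Reach; Reach-mono)

        Reach-· : ∀ {k u} w → All (λ ℓ → half ℓ ≡ h) w → Reach k u → Reach (length w + k) (u ·ʷ w)
        Reach-· [] [] reach = reach
        Reach-· {k} {u} (ℓ ∷ w) (hℓ ∷ hw) reach =
          subst (λ m → Reach m ((u · ℓ) ·ʷ w)) (+-suc (length w) k)
                (Reach-· w hw (inj₂ (u , (ℓ ⁻¹ , trans (half-⁻¹ ℓ) hℓ , ·-⁻¹ u ℓ) , reach)))

        reach : ∀ v → BreadthFirst.Reach (Step h) (step? h) r K v
        reach v with spans h v
        ... | w , hw , len≤K , refl =
          Reach-mono (subst (_≤ K) (sym (+-identityʳ (length w))) len≤K) (Reach-· w hw refl)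

      tree : Half → SpanningTree (Adj graph) r K
      tree h = SpanningTree-map (λ (ℓ , _ , e) → letter⇒adj ℓ e) (bfsTree h)

      InTree⇒Step : ∀ {h u v} → SpanningTree.InTree (bfsTree h) u v → Step h u v
      InTree⇒Step {h} (inj₁ (u≢r , refl)) = SpanningTree.parent-edge (bfsTree h) _ u≢r
      InTree⇒Step {h} (inj₂ (v≢r , refl)) with SpanningTree.parent-edge (bfsTree h) _ v≢r
      ... | ℓ , hℓ , e = ℓ ⁻¹ , trans (half-⁻¹ ℓ) hℓ , ·-flip ℓ e

      trees-disjoint : ∀ {u v} → SpanningTree.InTree (tree first) u v →
                       ¬ SpanningTree.InTree (tree second) u v
      trees-disjoint {u} t₁ t₂ with InTree⇒Step t₁ | InTree⇒Step t₂
      ... | ℓ₁ , h₁ , e₁ | ℓ₂ , h₂ , e₂ =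
        short-free u (ℓ₁ ∷ ℓ₂ ⁻¹ ∷ []) (different-halves , tt) (s≤s z≤n) (≤-trans (s≤s (s≤s (s≤s z≤n))) 3≤g)
          (trans (cong (_· ℓ₂ ⁻¹) (trans e₁ (sym e₂))) (·-⁻¹ u ℓ₂))
        where
        different-halves : ℓ₂ ⁻¹ ≢ ℓ₁ ⁻¹
        different-halves eq =
          case trans (sym h₂) (trans (sym (half-⁻¹ ℓ₂)) (trans (cong half eq) (trans (half-⁻¹ ℓ₁) h₁))) of λ ()

module IntegerMatrices where
  open import Data.Nat as ℕ using (zero; suc; z≤n; s≤s; _^_)
  import Data.Nat.Properties as ℕ
  open import Data.Nat.Tactic.RingSolver as ℕ-Solver using ()
  open import Data.Integer as ℤ using (ℤ; +_; +[1+_]; -[1+_]; _+_; _*_; -_; _-_; ∣_∣; 0ℤ; 1ℤ)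
  import Data.Integer.Properties as ℤ
  open import Data.Integer.Tactic.RingSolver using (solve-∀)
  open import Data.Empty using (⊥; ⊥-elim)
  open import Data.List using ([]; _∷_; length; foldl; foldr; _++_)
  open import Data.Product using (_,_; proj₁; proj₂)
  open import Data.Product.Properties using (≡-dec)
  open import Data.Sum using (_⊎_; inj₁; inj₂)
  open import Function using (_∘_)
  open import Relation.Nullary using (¬_; Dec; yes; no; contradiction)
  open import Relation.Binary.PropositionalEquality
  open CayleyGraphs using (Letter; letter; Half; first; second; Shape; upper; lower; Sign; pos; neg; _⁻¹; _≟ʰ_; _≟ˢ_)
  open CayleyGraphs using (Word; Reduced)
  open Letter

  record M₂ : Set where
    no-eta-equality
    pattern
    constructor mk
    field
      a b c d : ℤ

  infixl 7 _⊗_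
  _⊗_ : M₂ → M₂ → M₂
  mk a b c d ⊗ mk a′ b′ c′ d′ = mk (a * a′ + b * c′) (a * b′ + b * d′) (c * a′ + d * c′) (c * b′ + d * d′)

  𝟙 : M₂
  𝟙 = mk 1ℤ 0ℤ 0ℤ 1ℤ

  det : M₂ → ℤ
  det (mk a b c d) = a * d - b * c

  adjugate : M₂ → M₂
  adjugate (mk a b c d) = mk d (- b) (- c) a

  mk-cong : ∀ {a b c d a′ b′ c′ d′} → a ≡ a′ → b ≡ b′ → c ≡ c′ → d ≡ d′ → mk a b c d ≡ mk a′ b′ c′ d′
  mk-cong refl refl refl refl = refl

  ⊗-assoc : ∀ M N Q → (M ⊗ N) ⊗ Q ≡ M ⊗ (N ⊗ Q)
  ⊗-assoc (mk a b c d) (mk e f g h) (mk i j k l) =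
    mk-cong (entry a b e f g h i k) (entry a b e f g h j l) (entry c d e f g h i k) (entry c d e f g h j l)
    where
    entry : ∀ a b e f g h i k → (a * e + b * g) * i + (a * f + b * h) * k ≡ a * (e * i + f * k) + b * (g * i + h * k)
    entry = solve-∀

  ⊗-identityʳ : ∀ M → M ⊗ 𝟙 ≡ M
  ⊗-identityʳ (mk a b c d) = mk-cong (l a b) (r a b) (l c d) (r c d)
    where
    l : ∀ a b → a * 1ℤ + b * 0ℤ ≡ a
    l = solve-∀
    r : ∀ a b → a * 0ℤ + b * 1ℤ ≡ b
    r = solve-∀

  ⊗-identityˡ : ∀ M → 𝟙 ⊗ M ≡ M
  ⊗-identityˡ (mk a b c d) = mk-cong (l a c) (l b d) (r a c) (r b d)
    where
    l : ∀ a c → 1ℤ * a + 0ℤ * c ≡ a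
    l = solve-∀
    r : ∀ a c → 0ℤ * a + 1ℤ * c ≡ c
    r = solve-∀

  det-⊗ : ∀ M N → det (M ⊗ N) ≡ det M * det N
  det-⊗ (mk a b c d) (mk e f g h) = identity a b c d e f g h
    where
    identity : ∀ a b c d e f g h →
               (a * e + b * g) * (c * f + d * h) - (a * f + b * h) * (c * e + d * g) ≡ (a * d - b * c) * (e * h - f * g)
    identity = solve-∀

  adjugate-⊗ : ∀ M → adjugate M ⊗ M ≡ mk (det M) 0ℤ 0ℤ (det M)
  adjugate-⊗ (mk a b c d) = mk-cong (e₁ a b c d) (e₂ a b c d) (e₃ a b c d) (e₄ a b c d)
    where
    e₁ : ∀ a b c d → d * a + - b * c ≡ a * d - b * c
    e₁ = solve-∀
    e₂ : ∀ a b c d → d * b + - b * d ≡ 0ℤ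
    e₂ = solve-∀
    e₃ : ∀ a b c d → - c * a + a * c ≡ 0ℤ
    e₃ = solve-∀
    e₄ : ∀ a b c d → - c * b + a * d ≡ a * d - b * c
    e₄ = solve-∀

  ℤ² : Set
  ℤ² = ℤ × ℤ

  infixl 6 _⋆_
  _⋆_ : ℤ² → M₂ → ℤ²
  (x , y) ⋆ mk a b c d = x * a + y * c , x * b + y * d

  pair-cong : ∀ {x y x′ y′ : ℤ} → x ≡ x′ → y ≡ y′ → (x , y) ≡ (x′ , y′)
  pair-cong refl refl = refl

  ⋆-𝟙 : ∀ v → v ⋆ 𝟙 ≡ v
  ⋆-𝟙 (x , y) = pair-cong (l x y) (r x y)
    where
    l : ∀ x y → x * 1ℤ + y * 0ℤ ≡ x
    l = solve-∀
    r : ∀ x y → x * 0ℤ + y * 1ℤ ≡ y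
    r = solve-∀

  ⋆-⊗ : ∀ v M N → v ⋆ (M ⊗ N) ≡ v ⋆ M ⋆ N
  ⋆-⊗ (x , y) (mk a b c d) (mk e f g h) = pair-cong (entry x y a b c d e g) (entry x y a b c d f h)
    where
    entry : ∀ x y a b c d e g → x * (a * e + b * g) + y * (c * e + d * g) ≡ (x * a + y * c) * e + (x * b + y * d) * g
    entry = solve-∀

  ⟦_⟧ : Sign → ℤ
  ⟦ pos ⟧ = + 16
  ⟦ neg ⟧ = - + 16

  -- The second-half matrices are the conjugates 𝕙 ⊗ M ⊗ 𝕙⁻¹ of the first-half ones M.
  gen : Letter → M₂
  gen (letter first  upper σ)   = mk 1ℤ ⟦ σ ⟧ 0ℤ 1ℤ
  gen (letter first  lower σ)   = mk 1ℤ 0ℤ ⟦ σ ⟧ 1ℤ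
  gen (letter second upper pos) = mk (- + 7) (+ 8) (- + 8) (+ 9)
  gen (letter second upper neg) = mk (+ 9) (- + 8) (+ 8) (- + 7)
  gen (letter second lower pos) = mk (- + 7) (- + 8) (+ 8) (+ 9)
  gen (letter second lower neg) = mk (+ 9) (+ 8) (- + 8) (- + 7)

  𝕙 : M₂
  𝕙 = mk 1ℤ (- 1ℤ) 1ℤ 1ℤ

  𝕙-conj : ∀ s σ → 𝕙 ⊗ gen (letter first s σ) ≡ gen (letter second s σ) ⊗ 𝕙
  𝕙-conj upper pos = refl
  𝕙-conj upper neg = refl
  𝕙-conj lower pos = refl
  𝕙-conj lower neg = refl

  gen-⁻¹ : ∀ ℓ → gen ℓ ⊗ gen (ℓ ⁻¹) ≡ 𝟙
  gen-⁻¹ (letter first  upper pos) = refl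
  gen-⁻¹ (letter first  upper neg) = refl
  gen-⁻¹ (letter first  lower pos) = refl
  gen-⁻¹ (letter first  lower neg) = refl
  gen-⁻¹ (letter second upper pos) = refl
  gen-⁻¹ (letter second upper neg) = refl
  gen-⁻¹ (letter second lower pos) = refl
  gen-⁻¹ (letter second lower neg) = refl

  det-gen : ∀ ℓ → det (gen ℓ) ≡ 1ℤ
  det-gen (letter first  upper pos) = refl
  det-gen (letter first  upper neg) = refl
  det-gen (letter first  lower pos) = refl
  det-gen (letter first  lower neg) = refl
  det-gen (letter second upper pos) = refl
  det-gen (letter second upper neg) = refl
  det-gen (letter second lower pos) = refl
  det-gen (letter second lower neg) = refl

  prod : Word → M₂
  prod = foldr (λ ℓ M → gen ℓ ⊗ M) 𝟙

  prod-++ : ∀ w w′ → prod (w ++ w′) ≡ prod w ⊗ prod w′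
  prod-++ []      w′ = sym (⊗-identityˡ (prod w′))
  prod-++ (ℓ ∷ w) w′ = trans (cong (gen ℓ ⊗_) (prod-++ w w′)) (sym (⊗-assoc (gen ℓ) (prod w) (prod w′)))

  wide-clash : ∀ {a b s t} → 4 ℕ.* a ℕ.< b → 4 ℕ.* s ℕ.< t → b ℕ.≤ s ℕ.+ a → t ℕ.≤ a ℕ.+ b → ⊥
  wide-clash {a} {b} {s} {t} 4a<b 4s<t b≤s+a t≤a+b = ℕ.<-irrefl refl (begin-strict
    3 ℕ.* suc (4 ℕ.* a) ℕ.+ b  ≤⟨ ℕ.+-monoˡ-≤ b (ℕ.*-monoʳ-≤ 3 4a<b) ⟩
    3 ℕ.* b ℕ.+ b              ≡⟨ ℕ.+-comm (3 ℕ.* b) b ⟩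
    4 ℕ.* b                    ≤⟨ ℕ.*-monoʳ-≤ 4 b≤s+a ⟩
    4 ℕ.* (s ℕ.+ a)            ≡⟨ ℕ.*-distribˡ-+ 4 s a ⟩
    4 ℕ.* s ℕ.+ 4 ℕ.* a        <⟨ ℕ.+-monoˡ-< (4 ℕ.* a) 4s<t ⟩
    t ℕ.+ 4 ℕ.* a              ≤⟨ ℕ.+-monoˡ-≤ (4 ℕ.* a) t≤a+b ⟩
    a ℕ.+ b ℕ.+ 4 ℕ.* a        ≡⟨ rearrange a b ⟩
    5 ℕ.* a ℕ.+ b              ≤⟨ ℕ.+-monoˡ-≤ b (ℕ.m≤m+n (5 ℕ.* a) (7 ℕ.* a ℕ.+ 3)) ⟩
    5 ℕ.* a ℕ.+ (7 ℕ.* a ℕ.+ 3) ℕ.+ b ≡⟨ cong (ℕ._+ b) (twelve a) ⟩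
    3 ℕ.* suc (4 ℕ.* a) ℕ.+ b  ∎)
    where
    open ℕ.≤-Reasoning

    rearrange : ∀ a b → a ℕ.+ b ℕ.+ 4 ℕ.* a ≡ 5 ℕ.* a ℕ.+ b
    rearrange = ℕ-Solver.solve-∀
    twelve : ∀ a → 5 ℕ.* a ℕ.+ (7 ℕ.* a ℕ.+ 3) ≡ 3 ℕ.* suc (4 ℕ.* a)
    twelve = ℕ-Solver.solve-∀

  wide-swap-clash : ∀ {a b} → 4 ℕ.* a ℕ.< b → 4 ℕ.* b ℕ.< a → ⊥
  wide-swap-clash {a} {b} 4a<b 4b<a =
    ℕ.<-irrefl refl (ℕ.≤-<-trans (ℕ.m≤n*m a 4) (ℕ.<-≤-trans 4a<b (ℕ.≤-trans (ℕ.m≤n*m b 4) (ℕ.<⇒≤ 4b<a))))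

  Pos NonNeg : ℤ → Set
  Pos x    = ∃[ n ] x ≡ + suc n
  NonNeg x = ∃[ n ] x ≡ + n

  Pos-+ : ∀ {x y} → Pos x → Pos y → Pos (x + y)
  Pos-+ (m , refl) (n , refl) = m ℕ.+ suc n , refl

  NonNeg-+-Pos : ∀ {x y} → NonNeg x → Pos y → Pos (x + y)
  NonNeg-+-Pos (m , refl) (n , refl) = m ℕ.+ n , cong +_ (ℕ.+-suc m n)

  Pos-*ˡ : ∀ k {x} → Pos x → Pos (+ suc k * x)
  Pos-*ˡ k (n , refl) = n ℕ.+ k ℕ.* suc n , refl

  ∣∣≤⇒NonNeg : ∀ {q n} → ∣ q ∣ ℕ.≤ n → NonNeg (q + + n)
  ∣∣≤⇒NonNeg {+ k}      {n} _   = k ℕ.+ n , refl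
  ∣∣≤⇒NonNeg { -[1+ k ]} {n} k<n = n ℕ.∸ suc k , ℤ.⊖-≥ k<n

  shear : ℤ² → ℤ²
  shear (p , q) = p , q + + 16 * p

  negate : ℤ² → ℤ²
  negate (p , q) = - p , - q

  shear-negate : ∀ v → shear (negate v) ≡ negate (shear v)
  shear-negate (p , q) = cong (- p ,_) (identity p q)
    where
    identity : ∀ p q → - q + + 16 * - p ≡ - (q + + 16 * p)
    identity = solve-∀

  Cone⁺ : ℤ² → Set
  Cone⁺ (p , q) = Pos p × Pos (q - + 4 * p)

  Cone : ℤ² → Set
  Cone v = Cone⁺ v ⊎ Cone⁺ (negate v)

  Wide : ℤ² → Set
  Wide (p , q) = 4 ℕ.* ∣ p ∣ ℕ.< ∣ q ∣

  Cone⁺-shear : ∀ {v} → Cone⁺ v → Cone⁺ (shear v)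
  Cone⁺-shear {p , q} (p>0 , q>4p) = p>0 , subst Pos (identity p q) (Pos-+ q>4p (Pos-*ˡ 15 p>0))
    where
    identity : ∀ p q → q - + 4 * p + + 16 * p ≡ q + + 16 * p - + 4 * p
    identity = solve-∀

  Cone⁺-enter : ∀ {p q} → Pos p → ∣ q ∣ ℕ.≤ 4 ℕ.* ∣ p ∣ → Cone⁺ (shear (p , q))
  Cone⁺-enter {p} {q} p>0@(m , refl) q≤4p =
    p>0 , subst Pos (trans (cong (λ z → q + z + + 8 * p) (ℤ.pos-* 4 (suc m))) (identity p q))
                 (NonNeg-+-Pos (∣∣≤⇒NonNeg {q} q≤4p) (Pos-*ˡ 7 p>0))
    where
    identity : ∀ p q → q + + 4 * p + + 8 * p ≡ q + + 16 * p - + 4 * p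
    identity = solve-∀

  Cone-shear : ∀ {v} → Cone v → Cone (shear v)
  Cone-shear {v} (inj₁ c) = inj₁ (Cone⁺-shear {v} c)
  Cone-shear {v} (inj₂ c) = inj₂ (subst Cone⁺ (shear-negate v) (Cone⁺-shear {negate v} c))

  Cone-enter : ∀ {v} → ¬ Wide v → v ≢ (0ℤ , 0ℤ) → Cone (shear v)
  Cone-enter {+ zero   , q} narrow v≢0 =
    contradiction (cong (0ℤ ,_) (ℤ.∣i∣≡0⇒i≡0 (ℕ.n≤0⇒n≡0 (ℕ.≮⇒≥ narrow)))) v≢0
  Cone-enter {+[1+ m ] , q} narrow _ = inj₁ (Cone⁺-enter {q = q} (m , refl) (ℕ.≮⇒≥ narrow))
  Cone-enter { -[1+ m ] , q} narrow _ =
    inj₂ (subst Cone⁺ (shear-negate (-[1+ m ] , q))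
                (Cone⁺-enter {q = - q} (m , refl) (subst (ℕ._≤ 4 ℕ.* suc m) (sym (ℤ.∣-i∣≡∣i∣ q)) (ℕ.≮⇒≥ narrow))))

  Cone⁺⇒Wide : ∀ {v} → Cone⁺ v → Wide v
  Cone⁺⇒Wide {p , q} ((m , refl) , (n , q-4p≡)) =
    subst (λ z → 4 ℕ.* suc m ℕ.< ∣ z ∣) (sym q≡) (ℕ.m<n+m (4 ℕ.* suc m) (s≤s z≤n))
    where
    q≡ : q ≡ + (suc n ℕ.+ 4 ℕ.* suc m)
    q≡ = trans (identity q (+ suc m)) (cong₂ _+_ q-4p≡ (sym (ℤ.pos-* 4 (suc m))))
      where
      identity : ∀ q p → q ≡ q - + 4 * p + + 4 * p
      identity = solve-∀

  Wide-negate : ∀ {v} → Wide (negate v) → Wide v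
  Wide-negate {p , q} = subst₂ (λ x y → 4 ℕ.* x ℕ.< y) (ℤ.∣-i∣≡∣i∣ p) (ℤ.∣-i∣≡∣i∣ q)

  Cone⇒Wide : ∀ {v} → Cone v → Wide v
  Cone⇒Wide {v} (inj₁ c) = Cone⁺⇒Wide {v} c
  Cone⇒Wide {v} (inj₂ c) = Wide-negate {v} (Cone⁺⇒Wide {negate v} c)

  Axis : Set
  Axis = Half × Shape

  axis : Letter → Axis
  axis ℓ = half ℓ , shape ℓ

  _≟ᵃ_ : (a a′ : Axis) → Dec (a ≡ a′)
  _≟ᵃ_ = ≡-dec _≟ʰ_ _≟ˢ_

  same-axis : ∀ {ℓ ℓ′} → axis ℓ′ ≡ axis ℓ → ℓ′ ≡ ℓ ⊎ ℓ′ ≡ ℓ ⁻¹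
  same-axis {letter _ _ pos} {letter _ _ pos} refl = inj₁ refl
  same-axis {letter _ _ pos} {letter _ _ neg} refl = inj₂ refl
  same-axis {letter _ _ neg} {letter _ _ pos} refl = inj₂ refl
  same-axis {letter _ _ neg} {letter _ _ neg} refl = inj₁ refl

  shapeChart : Shape → ℤ² → ℤ²
  shapeChart upper v       = v
  shapeChart lower (x , y) = y , x

  axisChart : Axis → ℤ² → ℤ²
  axisChart (first  , s) v = shapeChart s v
  axisChart (second , s) v = shapeChart s (v ⋆ 𝕙)

  reflect : Sign → ℤ² → ℤ²
  reflect pos v       = v
  reflect neg (p , q) = p , - q

  chart : Letter → ℤ² → ℤ²
  chart ℓ v = reflect (sign ℓ) (axisChart (axis ℓ) v)

  chart-first : ∀ s σ v → chart (letter first s σ) (v ⋆ gen (letter first s σ)) ≡ shear (chart (letter first s σ) v)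
  chart-first upper pos (x , y) = pair-cong (e₁ x y) (e₂ x y)
    where
    e₁ : ∀ x y → x * 1ℤ + y * 0ℤ ≡ x
    e₁ = solve-∀
    e₂ : ∀ x y → x * + 16 + y * 1ℤ ≡ y + + 16 * x
    e₂ = solve-∀
  chart-first upper neg (x , y) = pair-cong (e₁ x y) (e₂ x y)
    where
    e₁ : ∀ x y → x * 1ℤ + y * 0ℤ ≡ x
    e₁ = solve-∀
    e₂ : ∀ x y → - (x * - + 16 + y * 1ℤ) ≡ - y + + 16 * x
    e₂ = solve-∀
  chart-first lower pos (x , y) = pair-cong (e₁ x y) (e₂ x y)
    where
    e₁ : ∀ x y → x * 0ℤ + y * 1ℤ ≡ y
    e₁ = solve-∀
    e₂ : ∀ x y → x * 1ℤ + y * + 16 ≡ x + + 16 * y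
    e₂ = solve-∀
  chart-first lower neg (x , y) = pair-cong (e₁ x y) (e₂ x y)
    where
    e₁ : ∀ x y → x * 0ℤ + y * 1ℤ ≡ y
    e₁ = solve-∀
    e₂ : ∀ x y → - (x * 1ℤ + y * - + 16) ≡ - x + + 16 * y
    e₂ = solve-∀

  chart-⋆ : ∀ ℓ v → chart ℓ (v ⋆ gen ℓ) ≡ shear (chart ℓ v)
  chart-⋆ (letter first  s σ) v = chart-first s σ v
  chart-⋆ (letter second s σ) v = trans (cong (chart (letter first s σ)) (begin
    v ⋆ gen (letter second s σ) ⋆ 𝕙    ≡⟨ ⋆-⊗ v _ 𝕙 ⟨
    v ⋆ (gen (letter second s σ) ⊗ 𝕙)  ≡⟨ cong (v ⋆_) (𝕙-conj s σ) ⟨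
    v ⋆ (𝕙 ⊗ gen (letter first s σ))   ≡⟨ ⋆-⊗ v 𝕙 _ ⟩
    v ⋆ 𝕙 ⋆ gen (letter first s σ)     ∎)) (chart-first s σ (v ⋆ 𝕙))
    where open ≡-Reasoning

  ≤-swap : ∀ {m} a b → m ℕ.≤ a ℕ.+ b → m ℕ.≤ b ℕ.+ a
  ≤-swap a b m≤a+b = ℕ.≤-trans m≤a+b (ℕ.≤-reflexive (ℕ.+-comm a b))

  WideAt : Axis → ℤ² → Set
  WideAt a v = Wide (axisChart a v)

  triangle : ∀ {i} j k → i ≡ j + k → ∣ i ∣ ℕ.≤ ∣ j ∣ ℕ.+ ∣ k ∣
  triangle j k refl = ℤ.∣i+j∣≤∣i∣+∣j∣ j k

  triangle′ : ∀ {i} j k → i ≡ j - k → ∣ i ∣ ℕ.≤ ∣ j ∣ ℕ.+ ∣ k ∣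
  triangle′ j k refl = ℤ.∣i-j∣≤∣i∣+∣j∣ j k

  module _ (x y : ℤ) where
    private
      s t : ℤ
      s = x * 1ℤ + y * 1ℤ
      t = x * - 1ℤ + y * 1ℤ

    y≤s+x : ∣ y ∣ ℕ.≤ ∣ s ∣ ℕ.+ ∣ x ∣
    y≤s+x = triangle′ s x (identity x y)
      where
      identity : ∀ x y → y ≡ x * 1ℤ + y * 1ℤ - x
      identity = solve-∀

    y≤t+x : ∣ y ∣ ℕ.≤ ∣ t ∣ ℕ.+ ∣ x ∣
    y≤t+x = triangle t x (identity x y)
      where
      identity : ∀ x y → y ≡ x * - 1ℤ + y * 1ℤ + x
      identity = solve-∀

    x≤s+y : ∣ x ∣ ℕ.≤ ∣ s ∣ ℕ.+ ∣ y ∣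
    x≤s+y = triangle′ s y (identity x y)
      where
      identity : ∀ x y → x ≡ x * 1ℤ + y * 1ℤ - y
      identity = solve-∀

    x≤t+y : ∣ x ∣ ℕ.≤ ∣ t ∣ ℕ.+ ∣ y ∣
    x≤t+y = ℕ.≤-trans (triangle′ y t (identity x y)) (ℕ.≤-reflexive (ℕ.+-comm ∣ y ∣ ∣ t ∣))
      where
      identity : ∀ x y → x ≡ y - (x * - 1ℤ + y * 1ℤ)
      identity = solve-∀

    s≤x+y : ∣ s ∣ ℕ.≤ ∣ x ∣ ℕ.+ ∣ y ∣
    s≤x+y = triangle x y (identity x y)
      where
      identity : ∀ x y → x * 1ℤ + y * 1ℤ ≡ x + y
      identity = solve-∀

    t≤y+x : ∣ t ∣ ℕ.≤ ∣ y ∣ ℕ.+ ∣ x ∣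
    t≤y+x = triangle′ y x (identity x y)
      where
      identity : ∀ x y → x * - 1ℤ + y * 1ℤ ≡ y - x
      identity = solve-∀

  WideAt-unique : ∀ a a′ {v} → WideAt a v → WideAt a′ v → a ≡ a′
  WideAt-unique (first  , upper) (first  , upper) _ _ = refl
  WideAt-unique (first  , lower) (first  , lower) _ _ = refl
  WideAt-unique (second , upper) (second , upper) _ _ = refl
  WideAt-unique (second , lower) (second , lower) _ _ = refl
  WideAt-unique (first  , upper) (first  , lower) w w′ = ⊥-elim (wide-swap-clash w w′)
  WideAt-unique (first  , lower) (first  , upper) w w′ = ⊥-elim (wide-swap-clash w′ w)
  WideAt-unique (second , upper) (second , lower) w w′ = ⊥-elim (wide-swap-clash w w′)
  WideAt-unique (second , lower) (second , upper) w w′ = ⊥-elim (wide-swap-clash w′ w)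
  WideAt-unique (first  , upper) (second , upper) {x , y} w w′ =
    ⊥-elim (wide-clash w w′ (y≤s+x x y) (≤-swap ∣ y ∣ ∣ x ∣ (t≤y+x x y)))
  WideAt-unique (second , upper) (first  , upper) {x , y} w w′ =
    ⊥-elim (wide-clash w′ w (y≤s+x x y) (≤-swap ∣ y ∣ ∣ x ∣ (t≤y+x x y)))
  WideAt-unique (first  , upper) (second , lower) {x , y} w w′ = ⊥-elim (wide-clash w w′ (y≤t+x x y) (s≤x+y x y))
  WideAt-unique (second , lower) (first  , upper) {x , y} w w′ = ⊥-elim (wide-clash w′ w (y≤t+x x y) (s≤x+y x y))
  WideAt-unique (first  , lower) (second , upper) {x , y} w w′ = ⊥-elim (wide-clash w w′ (x≤s+y x y) (t≤y+x x y))
  WideAt-unique (second , upper) (first  , lower) {x , y} w w′ = ⊥-elim (wide-clash w′ w (x≤s+y x y) (t≤y+x x y))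
  WideAt-unique (first  , lower) (second , lower) {x , y} w w′ =
    ⊥-elim (wide-clash w w′ (x≤t+y x y) (≤-swap ∣ x ∣ ∣ y ∣ (s≤x+y x y)))
  WideAt-unique (second , lower) (first  , lower) {x , y} w w′ =
    ⊥-elim (wide-clash w′ w (x≤t+y x y) (≤-swap ∣ x ∣ ∣ y ∣ (s≤x+y x y)))

  WideAt-zero : ∀ a → ¬ WideAt a (0ℤ , 0ℤ)
  WideAt-zero (first  , upper) ()
  WideAt-zero (first  , lower) ()
  WideAt-zero (second , upper) ()
  WideAt-zero (second , lower) ()

  Wide-reflect : ∀ σ {v} → Wide (reflect σ v) → Wide v
  Wide-reflect pos         w = w
  Wide-reflect neg {p , q} w = subst (4 ℕ.* ∣ p ∣ ℕ.<_) (ℤ.∣-i∣≡∣i∣ q) w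

  double-zero : ∀ x → x + x ≡ 0ℤ → x ≡ 0ℤ
  double-zero (+ zero)  _ = refl
  double-zero +[1+ _ ] ()
  double-zero -[1+ _ ] ()

  chart-nonzero : ∀ ℓ {v} → v ≢ (0ℤ , 0ℤ) → chart ℓ v ≢ (0ℤ , 0ℤ)
  chart-nonzero (letter h s σ) v≢0 = reflect-nonzero σ (axis-nonzero h s v≢0)
    where
    reflect-nonzero : ∀ σ {u} → u ≢ (0ℤ , 0ℤ) → reflect σ u ≢ (0ℤ , 0ℤ)
    reflect-nonzero pos u≢0 = u≢0
    reflect-nonzero neg {p , q} u≢0 e = u≢0 (pair-cong (cong proj₁ e) (ℤ.neg-injective (cong proj₂ e)))
    shape-nonzero : ∀ s {u} → u ≢ (0ℤ , 0ℤ) → shapeChart s u ≢ (0ℤ , 0ℤ)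
    shape-nonzero upper u≢0 = u≢0
    shape-nonzero lower u≢0 refl = u≢0 refl
    𝕙-nonzero : ∀ {u} → u ≢ (0ℤ , 0ℤ) → u ⋆ 𝕙 ≢ (0ℤ , 0ℤ)
    𝕙-nonzero {x , y} u≢0 e =
      u≢0 (pair-cong (double-zero x (trans (e₁ x y) (cong₂ _-_ (cong proj₁ e) (cong proj₂ e))))
                     (double-zero y (trans (e₂ x y) (cong₂ _+_ (cong proj₁ e) (cong proj₂ e)))))
      where
      e₁ : ∀ x y → x + x ≡ (x * 1ℤ + y * 1ℤ) - (x * - 1ℤ + y * 1ℤ)
      e₁ = solve-∀
      e₂ : ∀ x y → y + y ≡ (x * 1ℤ + y * 1ℤ) + (x * - 1ℤ + y * 1ℤ)
      e₂ = solve-∀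
    axis-nonzero : ∀ h s {u} → u ≢ (0ℤ , 0ℤ) → axisChart (h , s) u ≢ (0ℤ , 0ℤ)
    axis-nonzero first  s u≢0 = shape-nonzero s u≢0
    axis-nonzero second s u≢0 = shape-nonzero s (𝕙-nonzero u≢0)

  Region : Letter → ℤ² → Set
  Region ℓ v = Cone (chart ℓ v)

  Region⇒WideAt : ∀ ℓ {v} → Region ℓ v → WideAt (axis ℓ) v
  Region⇒WideAt ℓ {v} r = Wide-reflect (sign ℓ) (Cone⇒Wide {chart ℓ v} r)

  Region-nonzero : ∀ ℓ {v} → Region ℓ v → v ≢ (0ℤ , 0ℤ)
  Region-nonzero ℓ r refl = WideAt-zero (axis ℓ) (Region⇒WideAt ℓ r)

  enter : ∀ ℓ {v} → ¬ WideAt (axis ℓ) v → v ≢ (0ℤ , 0ℤ) → Region ℓ (v ⋆ gen ℓ)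
  enter ℓ {v} narrow v≢0 =
    subst Cone (sym (chart-⋆ ℓ v)) (Cone-enter {chart ℓ v} (narrow ∘ Wide-reflect (sign ℓ)) (chart-nonzero ℓ v≢0))

  stay : ∀ ℓ {v} → Region ℓ v → Region ℓ (v ⋆ gen ℓ)
  stay ℓ {v} r = subst Cone (sym (chart-⋆ ℓ v)) (Cone-shear {chart ℓ v} r)

  Region-step : ∀ ℓ ℓ′ {v} → Region ℓ v → ℓ′ ≢ ℓ ⁻¹ → Region ℓ′ (v ⋆ gen ℓ′)
  Region-step ℓ ℓ′ r ℓ′≢ℓ⁻¹ with axis ℓ′ ≟ᵃ axis ℓ
  ... | no differ =
    enter ℓ′ (λ w′ → differ (WideAt-unique (axis ℓ′) (axis ℓ) w′ (Region⇒WideAt ℓ r))) (Region-nonzero ℓ r)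
  ... | yes same with same-axis {ℓ} {ℓ′} same
  ...   | inj₁ refl   = stay ℓ r
  ...   | inj₂ ℓ′≡ℓ⁻¹ = contradiction ℓ′≡ℓ⁻¹ ℓ′≢ℓ⁻¹

  infixl 6 _⋆ʷ_
  _⋆ʷ_ : ℤ² → Word → ℤ²
  _⋆ʷ_ = foldl (λ v ℓ → v ⋆ gen ℓ)

  ⋆-prod : ∀ v w → v ⋆ prod w ≡ v ⋆ʷ w
  ⋆-prod v []      = ⋆-𝟙 v
  ⋆-prod v (ℓ ∷ w) = trans (⋆-⊗ v (gen ℓ) (prod w)) (⋆-prod (v ⋆ gen ℓ) w)

  Region-word : ∀ ℓ {v} w → Region ℓ v → Reduced (ℓ ∷ w) → ∃[ ℓ′ ] Region ℓ′ (v ⋆ʷ w)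
  Region-word ℓ []       r _                  = ℓ , r
  Region-word ℓ (ℓ′ ∷ w) r (ℓ′≢ℓ⁻¹ , reduced) = Region-word ℓ′ w (Region-step ℓ ℓ′ r ℓ′≢ℓ⁻¹) reduced

  v₀ : ℤ²
  v₀ = + 2 , + 1

  v₀-narrow : ∀ a → ¬ WideAt a v₀
  v₀-narrow (first  , upper) (s≤s ())
  v₀-narrow (first  , lower) (s≤s (s≤s ()))
  v₀-narrow (second , upper) (s≤s ())
  v₀-narrow (second , lower) (s≤s (s≤s (s≤s ())))

  ping-pong : ∀ ℓ w → Reduced (ℓ ∷ w) → v₀ ⋆ prod (ℓ ∷ w) ≢ v₀
  ping-pong ℓ w reduced e with Region-word ℓ w (enter ℓ (v₀-narrow (axis ℓ)) (λ ())) reduced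
  ... | ℓ′ , r =
    v₀-narrow (axis ℓ′) (subst (WideAt (axis ℓ′)) (trans (sym (⋆-prod v₀ (ℓ ∷ w))) e) (Region⇒WideAt ℓ′ r))

  ‖_‖ : ℤ² → ℕ
  ‖ x , y ‖ = ∣ x ∣ ℕ.⊔ ∣ y ∣

  columnNorm : M₂ → ℕ
  columnNorm (mk a b c d) = (∣ a ∣ ℕ.+ ∣ c ∣) ℕ.⊔ (∣ b ∣ ℕ.+ ∣ d ∣)

  columnNorm-gen : ∀ ℓ → columnNorm (gen ℓ) ≡ 17
  columnNorm-gen (letter first  upper pos) = refl
  columnNorm-gen (letter first  upper neg) = refl
  columnNorm-gen (letter first  lower pos) = refl
  columnNorm-gen (letter first  lower neg) = refl
  columnNorm-gen (letter second upper pos) = refl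
  columnNorm-gen (letter second upper neg) = refl
  columnNorm-gen (letter second lower pos) = refl
  columnNorm-gen (letter second lower neg) = refl

  ‖⋆‖≤ : ∀ v M → ‖ v ⋆ M ‖ ℕ.≤ columnNorm M ℕ.* ‖ v ‖
  ‖⋆‖≤ (x , y) (mk a b c d) =
    ℕ.⊔-lub (ℕ.≤-trans (entry a c) (ℕ.*-monoˡ-≤ ‖ x , y ‖ (ℕ.m≤m⊔n (∣ a ∣ ℕ.+ ∣ c ∣) (∣ b ∣ ℕ.+ ∣ d ∣))))
            (ℕ.≤-trans (entry b d) (ℕ.*-monoˡ-≤ ‖ x , y ‖ (ℕ.m≤n⊔m (∣ a ∣ ℕ.+ ∣ c ∣) (∣ b ∣ ℕ.+ ∣ d ∣))))
    where
    open ℕ.≤-Reasoning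
    entry : ∀ a c → ∣ x * a + y * c ∣ ℕ.≤ (∣ a ∣ ℕ.+ ∣ c ∣) ℕ.* ‖ x , y ‖
    entry a c = begin
      ∣ x * a + y * c ∣                                  ≤⟨ ℤ.∣i+j∣≤∣i∣+∣j∣ (x * a) (y * c) ⟩
      ∣ x * a ∣ ℕ.+ ∣ y * c ∣                            ≡⟨ cong₂ ℕ._+_ (ℤ.abs-* x a) (ℤ.abs-* y c) ⟩
      ∣ x ∣ ℕ.* ∣ a ∣ ℕ.+ ∣ y ∣ ℕ.* ∣ c ∣                ≤⟨ ℕ.+-mono-≤ (ℕ.*-monoˡ-≤ ∣ a ∣ (ℕ.m≤m⊔n ∣ x ∣ ∣ y ∣))
                                                                      (ℕ.*-monoˡ-≤ ∣ c ∣ (ℕ.m≤n⊔m ∣ x ∣ ∣ y ∣)) ⟩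
      ‖ x , y ‖ ℕ.* ∣ a ∣ ℕ.+ ‖ x , y ‖ ℕ.* ∣ c ∣        ≡⟨ ℕ.*-distribˡ-+ ‖ x , y ‖ ∣ a ∣ ∣ c ∣ ⟨
      ‖ x , y ‖ ℕ.* (∣ a ∣ ℕ.+ ∣ c ∣)                    ≡⟨ ℕ.*-comm ‖ x , y ‖ _ ⟩
      (∣ a ∣ ℕ.+ ∣ c ∣) ℕ.* ‖ x , y ‖                    ∎

  ‖⋆prod‖≤ : ∀ v w → ‖ v ⋆ prod w ‖ ℕ.≤ 17 ^ length w ℕ.* ‖ v ‖
  ‖⋆prod‖≤ v []      = ℕ.≤-reflexive (trans (cong ‖_‖ (⋆-𝟙 v)) (sym (ℕ.*-identityˡ ‖ v ‖)))
  ‖⋆prod‖≤ v (ℓ ∷ w) = begin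
    ‖ v ⋆ (gen ℓ ⊗ prod w) ‖              ≡⟨ cong ‖_‖ (⋆-⊗ v (gen ℓ) (prod w)) ⟩
    ‖ v ⋆ gen ℓ ⋆ prod w ‖                ≤⟨ ‖⋆prod‖≤ (v ⋆ gen ℓ) w ⟩
    17 ^ length w ℕ.* ‖ v ⋆ gen ℓ ‖       ≤⟨ ℕ.*-monoʳ-≤ (17 ^ length w) ‖v⋆gen‖≤ ⟩
    17 ^ length w ℕ.* (17 ℕ.* ‖ v ‖)      ≡⟨ ℕ.*-assoc (17 ^ length w) 17 ‖ v ‖ ⟨
    17 ^ length w ℕ.* 17 ℕ.* ‖ v ‖        ≡⟨ cong (ℕ._* ‖ v ‖) (ℕ.*-comm (17 ^ length w) 17) ⟩
    17 ^ suc (length w) ℕ.* ‖ v ‖         ∎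
    where
    open ℕ.≤-Reasoning
    ‖v⋆gen‖≤ : ‖ v ⋆ gen ℓ ‖ ℕ.≤ 17 ℕ.* ‖ v ‖
    ‖v⋆gen‖≤ = subst (λ k → ‖ v ⋆ gen ℓ ‖ ℕ.≤ k ℕ.* ‖ v ‖) (columnNorm-gen ℓ) (‖⋆‖≤ v (gen ℓ))

module Congruences where
  open import Data.Nat as ℕ using (zero; suc; z≤n; s≤s; _^_)
  import Data.Nat.Properties as ℕ
  open import Data.Nat.Divisibility using (∣⇒≤)
  open import Data.Nat.Primality using (Prime; prime⇒irreducible; prime⇒nonTrivial)
  open import Data.Nat.Coprimality using (Coprime; coprime-Bézout)
  open import Data.Nat.GCD using (module Bézout)
  open import Data.Integer as ℤ using (ℤ; +_; _+_; _*_; -_; _-_; ∣_∣; 0ℤ; 1ℤ)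
  import Data.Integer.Properties as ℤ
  open import Data.Integer.DivMod using (_%ℕ_; _/ℕ_; a≡a%ℕn+[a/ℕn]*n; n%ℕd<d)
  open import Data.Integer.Tactic.RingSolver using (solve-∀)
  open import Data.Fin using (Fin; zero; suc; toℕ; fromℕ<)
  import Data.Fin.Properties as Fin
  open import Data.List using (List; []; _∷_; length; lookup; filter; cartesianProduct; allFin)
  open import Data.List using (foldl; replicate; _++_; map)
  open import Data.List.Properties using (length-++; length-replicate; length-map)
  open import Data.List.Membership.Propositional using (_∈_)
  open import Data.List.Membership.Propositional.Properties
    using (∈-filter⁺; ∈-filter⁻; ∈-lookup; ∈-allFin; ∈-cartesianProduct⁺)
  open import Data.List.Relation.Unary.All using (All; []; _∷_)
  import Data.List.Relation.Unary.All as All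
  open import Data.List.Relation.Unary.All.Properties using (++⁺; replicate⁺)
  open import Data.List.Relation.Unary.AllPairs using (_∷_)
  open import Data.List.Relation.Unary.Any using (index)
  open import Data.List.Relation.Unary.Any.Properties using (lookup-index)
  open import Data.List.Relation.Unary.Unique.Propositional using (Unique)
  open import Data.List.Relation.Unary.Unique.Propositional.Properties using (filter⁺; cartesianProduct⁺; allFin⁺)
  open import Data.Product using (_,_; proj₁; proj₂)
  open import Data.Sum using (inj₁; inj₂)
  open import Function using (_∘_)
  open import Relation.Nullary using (¬_; Dec; yes; no; contradiction)
  open import Relation.Unary using (Decidable)
  open import Relation.Binary using (Setoid)
  open import Relation.Binary.PropositionalEquality
  open CayleyGraphs using (Letter; letter; Half; first; second; upper; lower; pos; _⁻¹; Word; Reduced)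
  open Letter
  open IntegerMatrices

  module Modular (p : ℕ) .{{_ : NonZero p}} where

    infix 4 _≋_
    record _≋_ (x y : ℤ) : Set where
      constructor mod
      field
        quotient : ℤ
        equation : x ≡ y + quotient * + p

    ≋-refl : ∀ {x} → x ≋ x
    ≋-refl {x} = mod 0ℤ (identity x (+ p))
      where
      identity : ∀ x q → x ≡ x + 0ℤ * q
      identity = solve-∀

    ≡⇒≋ : ∀ {x y} → x ≡ y → x ≋ y
    ≡⇒≋ refl = ≋-refl

    ≋-sym : ∀ {x y} → x ≋ y → y ≋ x
    ≋-sym {y = y} (mod k refl) = mod (- k) (identity y k (+ p))
      where
      identity : ∀ y k q → y ≡ y + k * q + - k * q
      identity = solve-∀

    ≋-trans : ∀ {x y z} → x ≋ y → y ≋ z → x ≋ z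
    ≋-trans {z = z} (mod k refl) (mod l refl) = mod (l + k) (identity z k l (+ p))
      where
      identity : ∀ z k l q → z + l * q + k * q ≡ z + (l + k) * q
      identity = solve-∀

    ≋-setoid : Setoid _ _
    ≋-setoid = record
      { Carrier = ℤ ; _≈_ = _≋_
      ; isEquivalence = record { refl = ≋-refl ; sym = ≋-sym ; trans = λ {x y z} → ≋-trans {x} {y} {z} } }

    +-cong : ∀ {x x′ y y′} → x ≋ x′ → y ≋ y′ → x + y ≋ x′ + y′
    +-cong {x′ = x′} {y′ = y′} (mod k refl) (mod l refl) = mod (k + l) (identity x′ y′ k l (+ p))
      where
      identity : ∀ x y k l q → x + k * q + (y + l * q) ≡ x + y + (k + l) * q
      identity = solve-∀

    *-cong : ∀ {x x′ y y′} → x ≋ x′ → y ≋ y′ → x * y ≋ x′ * y′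
    *-cong {x′ = x′} {y′ = y′} (mod k refl) (mod l refl) =
      mod (k * y′ + x′ * l + k * l * + p) (identity x′ y′ k l (+ p))
      where
      identity : ∀ x y k l q → (x + k * q) * (y + l * q) ≡ x * y + (k * y + x * l + k * l * q) * q
      identity = solve-∀

    neg-cong : ∀ {x x′} → x ≋ x′ → - x ≋ - x′
    neg-cong {x′ = x′} (mod k refl) = mod (- k) (identity x′ k (+ p))
      where
      identity : ∀ x k q → - (x + k * q) ≡ - x + - k * q
      identity = solve-∀

    sub-cong : ∀ {x x′ y y′} → x ≋ x′ → y ≋ y′ → x - y ≋ x′ - y′
    sub-cong x≋x′ y≋y′ = +-cong x≋x′ (neg-cong y≋y′)

    small-≋⇒≡ : ∀ {x y} → x ≋ y → ∣ x - y ∣ ℕ.< p → x ≡ y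
    small-≋⇒≡ {x} {y} (mod k x≡) small with k ℤ.≟ 0ℤ
    ... | yes refl = trans x≡ (identity y (+ p))
      where
      identity : ∀ y q → y + 0ℤ * q ≡ y
      identity = solve-∀
    ... | no k≢0 = contradiction small (ℕ.≤⇒≯ (begin
      p                     ≤⟨ ℕ.m≤n*m p ∣ k ∣ {{ℕ.≢-nonZero (k≢0 ∘ ℤ.∣i∣≡0⇒i≡0)}} ⟩
      ∣ k ∣ ℕ.* p           ≡⟨ ℤ.abs-* k (+ p) ⟨
      ∣ k * + p ∣           ≡⟨ cong ∣_∣ (trans (sym (cancel y (k * + p))) (cong (_- y) (sym x≡))) ⟩
      ∣ x - y ∣             ∎))
      where
      open ℕ.≤-Reasoning
      cancel : ∀ y z → y + z - y ≡ z
      cancel = solve-∀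

    residue : ℤ → ℕ
    residue x = x %ℕ p

    residue<p : ∀ x → residue x ℕ.< p
    residue<p x = n%ℕd<d x p

    ≋-residue : ∀ x → x ≋ + residue x
    ≋-residue x = mod (x /ℕ p) (a≡a%ℕn+[a/ℕn]*n x p)

    residue-injective : ∀ {r s} → r ℕ.< p → s ℕ.< p → + r ≋ + s → r ≡ s
    residue-injective {r} {s} r<p s<p r≋s = ℤ.+-injective (small-≋⇒≡ r≋s (begin-strict
      ∣ + r - + s ∣    ≡⟨ cong ∣_∣ (ℤ.m-n≡m⊖n r s) ⟩
      ∣ r ℤ.⊖ s ∣      ≤⟨ ℤ.∣m⊝n∣≤m⊔n r s ⟩
      r ℕ.⊔ s          <⟨ ℕ.⊔-lub r<p s<p ⟩
      p                ∎))
      where open ℕ.≤-Reasoning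

    residue-cong : ∀ {x y} → x ≋ y → residue x ≡ residue y
    residue-cong {x} {y} x≋y =
      residue-injective (residue<p x) (residue<p y) (≋-trans (≋-sym (≋-residue x)) (≋-trans x≋y (≋-residue y)))

    residue-of-residue : ∀ {r} → r ℕ.< p → residue (+ r) ≡ r
    residue-of-residue {r} r<p = residue-injective (residue<p (+ r)) r<p (≋-sym (≋-residue (+ r)))

    infix 4 _≋ᴹ_
    record _≋ᴹ_ (M N : M₂) : Set where
      constructor mk≋
      field
        a≋ : M₂.a M ≋ M₂.a N
        b≋ : M₂.b M ≋ M₂.b N
        c≋ : M₂.c M ≋ M₂.c N
        d≋ : M₂.d M ≋ M₂.d N

    ≋ᴹ-refl : ∀ {M} → M ≋ᴹ M
    ≋ᴹ-refl = mk≋ ≋-refl ≋-refl ≋-refl ≋-refl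

    ≡⇒≋ᴹ : ∀ {M N} → M ≡ N → M ≋ᴹ N
    ≡⇒≋ᴹ refl = ≋ᴹ-refl

    ≋ᴹ-sym : ∀ {M N} → M ≋ᴹ N → N ≋ᴹ M
    ≋ᴹ-sym (mk≋ a b c d) = mk≋ (≋-sym a) (≋-sym b) (≋-sym c) (≋-sym d)

    ≋ᴹ-trans : ∀ {M N Q} → M ≋ᴹ N → N ≋ᴹ Q → M ≋ᴹ Q
    ≋ᴹ-trans (mk≋ a b c d) (mk≋ a′ b′ c′ d′) = mk≋ (≋-trans a a′) (≋-trans b b′) (≋-trans c c′) (≋-trans d d′)

    ≋ᴹ-setoid : Setoid _ _
    ≋ᴹ-setoid = record
      { Carrier = M₂ ; _≈_ = _≋ᴹ_
      ; isEquivalence = record { refl = ≋ᴹ-refl ; sym = ≋ᴹ-sym ; trans = λ {M N Q} → ≋ᴹ-trans {M} {N} {Q} } }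

    ⊗-cong : ∀ {M M′ N N′} → M ≋ᴹ M′ → N ≋ᴹ N′ → M ⊗ N ≋ᴹ M′ ⊗ N′
    ⊗-cong {mk _ _ _ _} {mk _ _ _ _} {mk _ _ _ _} {mk _ _ _ _} (mk≋ a b c d) (mk≋ e f g h) =
      mk≋ (+-cong (*-cong a e) (*-cong b g)) (+-cong (*-cong a f) (*-cong b h))
          (+-cong (*-cong c e) (*-cong d g)) (+-cong (*-cong c f) (*-cong d h))

    det-cong : ∀ {M N} → M ≋ᴹ N → det M ≋ det N
    det-cong {mk _ _ _ _} {mk _ _ _ _} (mk≋ a b c d) = sub-cong (*-cong a d) (*-cong b c)

    ⋆-cong : ∀ v {M N} → M ≋ᴹ N → proj₁ (v ⋆ M) ≋ proj₁ (v ⋆ N) × proj₂ (v ⋆ M) ≋ proj₂ (v ⋆ N)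
    ⋆-cong (x , y) {mk _ _ _ _} {mk _ _ _ _} (mk≋ a b c d) =
      +-cong (*-cong (≋-refl {x}) a) (*-cong (≋-refl {y}) c) , +-cong (*-cong (≋-refl {x}) b) (*-cong (≋-refl {y}) d)

    scalar-≋ᴹ : ∀ {δ} → δ ≋ 1ℤ → ∀ M → mk δ 0ℤ 0ℤ δ ⊗ M ≋ᴹ M
    scalar-≋ᴹ {δ} δ≋1 (mk a b c d) = mk≋ (left a c) (left b d) (right c a) (right d b)
      where
      left : ∀ x y → δ * x + 0ℤ * y ≋ x
      left x y = ≋-trans (+-cong (*-cong δ≋1 (≋-refl {x})) (≋-refl {0ℤ * y})) (≡⇒≋ (identity x y))
        where
        identity : ∀ x y → 1ℤ * x + 0ℤ * y ≡ x
        identity = solve-∀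
      right : ∀ x y → 0ℤ * y + δ * x ≋ x
      right x y = ≋-trans (+-cong (≋-refl {0ℤ * y}) (*-cong δ≋1 (≋-refl {x}))) (≡⇒≋ (identity x y))
        where
        identity : ∀ x y → 0ℤ * y + 1ℤ * x ≡ x
        identity = solve-∀

    ⊗-cancelˡ : ∀ M {X Y} → det M ≋ 1ℤ → M ⊗ X ≋ᴹ M ⊗ Y → X ≋ᴹ Y
    ⊗-cancelˡ M {X} {Y} det≋1 MX≋MY = begin
      X                          ≈⟨ scalar-≋ᴹ det≋1 X ⟨
      mk (det M) 0ℤ 0ℤ (det M) ⊗ X ≡⟨ cong (_⊗ X) (adjugate-⊗ M) ⟨
      adjugate M ⊗ M ⊗ X         ≡⟨ ⊗-assoc (adjugate M) M X ⟩
      adjugate M ⊗ (M ⊗ X)       ≈⟨ ⊗-cong (≋ᴹ-refl {adjugate M}) MX≋MY ⟩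
      adjugate M ⊗ (M ⊗ Y)       ≡⟨ ⊗-assoc (adjugate M) M Y ⟨
      adjugate M ⊗ M ⊗ Y         ≡⟨ cong (_⊗ Y) (adjugate-⊗ M) ⟩
      mk (det M) 0ℤ 0ℤ (det M) ⊗ Y ≈⟨ scalar-≋ᴹ det≋1 Y ⟩
      Y                          ∎
      where open import Relation.Binary.Reasoning.Setoid ≋ᴹ-setoid

    relator-free : ∀ w → Reduced w → 0 ℕ.< length w → 17 ^ length w ℕ.* 2 ℕ.+ 2 ℕ.< p → ¬ prod w ≋ᴹ 𝟙
    relator-free (ℓ ∷ w) reduced _ small w≋𝟙 = ping-pong ℓ w reduced
      (pair-cong (exact x≋2 (ℕ.m≤m⊔n ∣ x ∣ ∣ y ∣) ℕ.≤-refl) (exact y≋1 (ℕ.m≤n⊔m ∣ x ∣ ∣ y ∣) (s≤s z≤n)))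
      where
      x y : ℤ
      x = proj₁ (v₀ ⋆ prod (ℓ ∷ w))
      y = proj₂ (v₀ ⋆ prod (ℓ ∷ w))
      x≋2 : x ≋ + 2
      x≋2 = proj₁ (⋆-cong v₀ w≋𝟙)
      y≋1 : y ≋ + 1
      y≋1 = proj₂ (⋆-cong v₀ w≋𝟙)
      exact : ∀ {z r} → z ≋ + r → ∣ z ∣ ℕ.≤ ‖ v₀ ⋆ prod (ℓ ∷ w) ‖ → r ℕ.≤ 2 → z ≡ + r
      exact {z} {r} z≋r z≤ r≤2 = small-≋⇒≡ z≋r (ℕ.≤-<-trans (ℕ.≤-trans (ℤ.∣i-j∣≤∣i∣+∣j∣ z (+ r))
        (ℕ.+-mono-≤ (ℕ.≤-trans z≤ (‖⋆prod‖≤ v₀ (ℓ ∷ w))) r≤2)) small)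

  lookup-injective : ∀ {A : Set} {xs : List A} → Unique xs → ∀ {i j} → lookup xs i ≡ lookup xs j → i ≡ j
  lookup-injective {xs = _ ∷ _} (_ ∷ _)     {zero}  {zero}  _ = refl
  lookup-injective {xs = _ ∷ _} (x∉ ∷ _)   {zero}  {suc j} e = contradiction e (All.lookup x∉ (∈-lookup j))
  lookup-injective {xs = _ ∷ _} (x∉ ∷ _)   {suc i} {zero}  e = contradiction (sym e) (All.lookup x∉ (∈-lookup i))
  lookup-injective {xs = _ ∷ _} (_ ∷ uniq) {suc i} {suc j} e = cong suc (lookup-injective uniq e)

  module Enumeration {A : Set} (xs : List A) (∈-xs : ∀ x → x ∈ xs) (xs-unique : Unique xs)
                     {P : A → Set} (P? : Decidable P) where

    -- Abstract: in the application the list has p⁴ entries and must never be unfolded.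
    abstract
      size : ℕ
      size = length (filter P? xs)

      element : Fin size → A
      element = lookup (filter P? xs)

      element-P : ∀ i → P (element i)
      element-P i = proj₂ (∈-filter⁻ P? {xs = xs} (∈-lookup i))

      index-of : ∀ x → P x → Fin size
      index-of x px = index (∈-filter⁺ P? (∈-xs x) px)

      element-index-of : ∀ x px → element (index-of x px) ≡ x
      element-index-of x px = sym (lookup-index (∈-filter⁺ P? (∈-xs x) px))

      element-injective : ∀ {i j} → element i ≡ element j → i ≡ j
      element-injective = lookup-injective (filter⁺ P? xs-unique)

  module SpecialLinear (p : ℕ) .{{_ : NonZero p}} (1<p : 1 ℕ.< p) where
    open Modular p

    Residues : Set
    Residues = Fin p × Fin p × Fin p × Fin p

    toM₂ : Residues → M₂
    toM₂ (a , b , c , d) = mk (+ toℕ a) (+ toℕ b) (+ toℕ c) (+ toℕ d)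

    reduce : M₂ → Residues
    reduce (mk a b c d) = r a , r b , r c , r d
      where
      r : ℤ → Fin p
      r x = fromℕ< (residue<p x)

    toM₂-reduce : ∀ M → toM₂ (reduce M) ≋ᴹ M
    toM₂-reduce (mk a b c d) = mk≋ (back a) (back b) (back c) (back d)
      where
      back : ∀ x → + toℕ (fromℕ< (residue<p x)) ≋ x
      back x = subst (_≋ x) (cong +_ (sym (Fin.toℕ-fromℕ< (residue<p x)))) (≋-sym (≋-residue x))

    reduce-cong : ∀ {M N} → M ≋ᴹ N → reduce M ≡ reduce N
    reduce-cong {mk _ _ _ _} {mk _ _ _ _} (mk≋ a b c d) =
      cong₂ _,_ (r a) (cong₂ _,_ (r b) (cong₂ _,_ (r c) (r d)))
      where
      r : ∀ {x y} → x ≋ y → fromℕ< (residue<p x) ≡ fromℕ< (residue<p y)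
      r {x} {y} x≋y = Fin.fromℕ<-cong _ _ (residue-cong x≋y) (residue<p x) (residue<p y)

    reduce-toM₂ : ∀ q → reduce (toM₂ q) ≡ q
    reduce-toM₂ (a , b , c , d) = cong₂ _,_ (r a) (cong₂ _,_ (r b) (cong₂ _,_ (r c) (r d)))
      where
      r : ∀ (i : Fin p) → fromℕ< (residue<p (+ toℕ i)) ≡ i
      r i = trans (Fin.fromℕ<-cong _ _ (residue-of-residue (Fin.toℕ<n i)) (residue<p (+ toℕ i)) (Fin.toℕ<n i))
                  (Fin.fromℕ<-toℕ i (Fin.toℕ<n i))

    residues : List Residues
    residues = cartesianProduct (allFin p) (cartesianProduct (allFin p) (cartesianProduct (allFin p) (allFin p)))

    ∈-residues : ∀ q → q ∈ residues
    ∈-residues (a , b , c , d) = ∈-cartesianProduct⁺ (∈-allFin a)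
      (∈-cartesianProduct⁺ (∈-allFin b) (∈-cartesianProduct⁺ (∈-allFin c) (∈-allFin d)))

    residues-unique : Unique residues
    residues-unique =
      cartesianProduct⁺ (allFin⁺ p) (cartesianProduct⁺ (allFin⁺ p) (cartesianProduct⁺ (allFin⁺ p) (allFin⁺ p)))

    Special : Residues → Set
    Special q = residue (det (toM₂ q)) ≡ 1

    open Enumeration residues ∈-residues residues-unique {Special} (λ q → residue (det (toM₂ q)) ℕ.≟ 1)

    Vertex : Set
    Vertex = Fin size

    matrix : Vertex → M₂
    matrix = toM₂ ∘ element

    det-matrix : ∀ v → det (matrix v) ≋ 1ℤ
    det-matrix v = ≋-trans (≋-residue (det (matrix v))) (≡⇒≋ (cong +_ (element-P v)))

    vertex : ∀ M → det M ≋ 1ℤ → Vertex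
    vertex M det≋1 = index-of (reduce M) special
      where
      special : Special (reduce M)
      special = trans (residue-cong (≋-trans (det-cong (toM₂-reduce M)) det≋1)) (residue-of-residue 1<p)

    matrix-vertex : ∀ M det≋1 → matrix (vertex M det≋1) ≋ᴹ M
    matrix-vertex M det≋1 = subst (λ q → toM₂ q ≋ᴹ M) (sym (element-index-of _ _)) (toM₂-reduce M)

    matrix-injective : ∀ {u v} → matrix u ≋ᴹ matrix v → u ≡ v
    matrix-injective {u} {v} uv = element-injective (begin
      element u                  ≡⟨ reduce-toM₂ (element u) ⟨
      reduce (matrix u)          ≡⟨ reduce-cong uv ⟩
      reduce (matrix v)          ≡⟨ reduce-toM₂ (element v) ⟩
      element v                  ∎)
      where open ≡-Reasoning

    open import Relation.Binary.Reasoning.Setoid ≋ᴹ-setoid renaming (begin_ to beginᴹ_; _∎ to _∎ᴹ)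

    root : Vertex
    root = vertex 𝟙 ≋-refl

    infixl 5 _·_
    _·_ : Vertex → Letter → Vertex
    v · ℓ = vertex (matrix v ⊗ gen ℓ) det≋1
      where
      det≋1 : det (matrix v ⊗ gen ℓ) ≋ 1ℤ
      det≋1 = ≋-trans (≡⇒≋ (trans (det-⊗ (matrix v) (gen ℓ)) (cong (det (matrix v) *_) (det-gen ℓ))))
                      (*-cong (det-matrix v) (≋-refl {1ℤ}))

    matrix-· : ∀ v ℓ → matrix (v · ℓ) ≋ᴹ matrix v ⊗ gen ℓ
    matrix-· v ℓ = matrix-vertex _ _

    ·-⁻¹ : ∀ v ℓ → v · ℓ · ℓ ⁻¹ ≡ v
    ·-⁻¹ v ℓ = matrix-injective (beginᴹ
      matrix (v · ℓ · ℓ ⁻¹)            ≈⟨ matrix-· (v · ℓ) (ℓ ⁻¹) ⟩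
      matrix (v · ℓ) ⊗ gen (ℓ ⁻¹)      ≈⟨ ⊗-cong (matrix-· v ℓ) ≋ᴹ-refl ⟩
      matrix v ⊗ gen ℓ ⊗ gen (ℓ ⁻¹)    ≡⟨ ⊗-assoc (matrix v) (gen ℓ) (gen (ℓ ⁻¹)) ⟩
      matrix v ⊗ (gen ℓ ⊗ gen (ℓ ⁻¹))  ≡⟨ cong (matrix v ⊗_) (gen-⁻¹ ℓ) ⟩
      matrix v ⊗ 𝟙                     ≡⟨ ⊗-identityʳ (matrix v) ⟩
      matrix v                         ∎ᴹ)

    matrix-·ʷ : ∀ v w → matrix (foldl _·_ v w) ≋ᴹ matrix v ⊗ prod w
    matrix-·ʷ v []      = ≡⇒≋ᴹ (sym (⊗-identityʳ (matrix v)))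
    matrix-·ʷ v (ℓ ∷ w) = beginᴹ
      matrix (foldl _·_ (v · ℓ) w)   ≈⟨ matrix-·ʷ (v · ℓ) w ⟩
      matrix (v · ℓ) ⊗ prod w        ≈⟨ ⊗-cong (matrix-· v ℓ) ≋ᴹ-refl ⟩
      matrix v ⊗ gen ℓ ⊗ prod w      ≡⟨ ⊗-assoc (matrix v) (gen ℓ) (prod w) ⟩
      matrix v ⊗ (gen ℓ ⊗ prod w)    ∎ᴹ

    fixed⇒relator : ∀ v w → foldl _·_ v w ≡ v → prod w ≋ᴹ 𝟙
    fixed⇒relator v w fixed = ⊗-cancelˡ (matrix v) (det-matrix v) (beginᴹ
      matrix v ⊗ prod w              ≈⟨ matrix-·ʷ v w ⟨
      matrix (foldl _·_ v w)         ≡⟨ cong matrix fixed ⟩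
      matrix v                       ≡⟨ ⊗-identityʳ (matrix v) ⟨
      matrix v ⊗ 𝟙                   ∎ᴹ)

    root-·ʷ : ∀ v w → prod w ≋ᴹ matrix v → foldl _·_ root w ≡ v
    root-·ʷ v w w≋v = matrix-injective (beginᴹ
      matrix (foldl _·_ root w)      ≈⟨ matrix-·ʷ root w ⟩
      matrix root ⊗ prod w           ≈⟨ ⊗-cong (matrix-vertex 𝟙 ≋-refl) w≋v ⟩
      𝟙 ⊗ matrix v                   ≡⟨ ⊗-identityˡ (matrix v) ⟩
      matrix v                       ∎ᴹ)

  module Field (p : ℕ) .{{_ : NonZero p}} (prime : Prime p) where
    open Modular p

    residue≡0 : ∀ {x} → residue x ≡ 0 → x ≋ 0ℤ
    residue≡0 {x} r≡0 = ≋-trans (≋-residue x) (≡⇒≋ (cong +_ r≡0))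

    _≋0? : ∀ x → Dec (x ≋ 0ℤ)
    x ≋0? with residue x ℕ.≟ 0
    ... | yes r≡0 = yes (residue≡0 r≡0)
    ... | no  r≢0 = no λ x≋0 → r≢0 (trans (residue-cong x≋0) (residue-of-residue (ℕ.>-nonZero⁻¹ p)))

    inverse : ∀ x → ¬ x ≋ 0ℤ → ∃[ y ] x * y ≋ 1ℤ
    inverse x x≉0 with coprime-Bézout coprime
      where
      r = residue x
      coprime : Coprime r p
      coprime {d} (d∣r , d∣p) with prime⇒irreducible prime d∣p
      ... | inj₁ d≡1    = d≡1
      ... | inj₂ refl   = contradiction (∣⇒≤ {{ℕ.≢-nonZero (x≉0 ∘ residue≡0)}} d∣r) (ℕ.<⇒≱ (residue<p x))
    ... | Bézout.+- a b eq = + a , ≋-trans (*-cong (≋-residue x) (≋-refl {+ a})) (mod (+ b) (begin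
      + residue x * + a          ≡⟨ ℤ.pos-* (residue x) a ⟨
      + (residue x ℕ.* a)        ≡⟨ cong +_ (trans (ℕ.*-comm (residue x) a) (sym eq)) ⟩
      + (1 ℕ.+ b ℕ.* p)          ≡⟨ cong (λ z → 1ℤ + z) (ℤ.pos-* b p) ⟩
      1ℤ + + b * + p             ∎))
      where open ≡-Reasoning
    ... | Bézout.-+ a b eq = - + a , ≋-trans (*-cong (≋-residue x) (≋-refl { - + a})) (mod (- + b) (begin
      + residue x * - + a              ≡⟨ negated (+ residue x) (+ a) ⟩
      1ℤ - (1ℤ + + a * + residue x)    ≡⟨ cong (λ z → 1ℤ - (1ℤ + z)) (ℤ.pos-* a (residue x)) ⟨
      1ℤ - + (1 ℕ.+ a ℕ.* residue x)   ≡⟨ cong (λ z → 1ℤ - + z) eq ⟩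
      1ℤ - + (b ℕ.* p)                 ≡⟨ cong (λ z → 1ℤ - z) (ℤ.pos-* b p) ⟩
      1ℤ - + b * + p                   ≡⟨ minus (+ b) (+ p) ⟩
      1ℤ + - + b * + p                 ∎))
      where
      open ≡-Reasoning
      negated : ∀ r a → r * - a ≡ 1ℤ - (1ℤ + a * r)
      negated = solve-∀
      minus : ∀ b q → 1ℤ - b * q ≡ 1ℤ + - b * q
      minus = solve-∀

    small-≉0 : ∀ {r} → r ℕ.< p → r ≢ 0 → ¬ + r ≋ 0ℤ
    small-≉0 {r} r<p r≢0 r≋0 = r≢0 (residue-injective r<p (ℕ.≤-<-trans z≤n r<p) r≋0)

    0≉1 : ¬ 0ℤ ≋ 1ℤ
    0≉1 = small-≉0 (ℕ.nonTrivial⇒n>1 p {{prime⇒nonTrivial prime}}) (λ ()) ∘ ≋-sym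

    *-≉0 : ∀ {x y} → ¬ x ≋ 0ℤ → ¬ y ≋ 0ℤ → ¬ x * y ≋ 0ℤ
    *-≉0 {x} {y} x≉0 y≉0 xy≋0 = y≉0 (begin
      y                      ≡⟨ ℤ.*-identityʳ y ⟨
      y * 1ℤ                 ≈⟨ *-cong (≋-refl {y}) (≋-sym (proj₂ (inverse x x≉0))) ⟩
      y * (x * x⁻¹)          ≡⟨ reassociate x y x⁻¹ ⟩
      x * y * x⁻¹            ≈⟨ *-cong xy≋0 (≋-refl {x⁻¹}) ⟩
      0ℤ * x⁻¹               ≡⟨ ℤ.*-zeroˡ x⁻¹ ⟩
      0ℤ                     ∎)
      where
      open import Relation.Binary.Reasoning.Setoid ≋-setoid
      x⁻¹ = proj₁ (inverse x x≉0)
      reassociate : ∀ x y i → y * (x * i) ≡ x * y * i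
      reassociate = solve-∀

  module Generation (p : ℕ) .{{_ : NonZero p}} (prime : Prime p) (16<p : 16 ℕ.< p) where
    open Modular p
    open Field p prime

    sixteenth : ∃[ s ] + 16 * s ≋ 1ℤ
    sixteenth = inverse (+ 16) (small-≉0 16<p (λ ()))

    multiple-of-16 : ∀ t → ∃[ n ] (n ℕ.< p × + 16 * + n ≋ t)
    multiple-of-16 t = residue (t * s) , residue<p (t * s) , (begin
      + 16 * + residue (t * s) ≈⟨ *-cong (≋-refl {+ 16}) (≋-sym (≋-residue (t * s))) ⟩
      + 16 * (t * s)           ≡⟨ reassociate t s ⟩
      t * (+ 16 * s)           ≈⟨ *-cong (≋-refl {t}) (proj₂ sixteenth) ⟩
      t * 1ℤ                   ≡⟨ ℤ.*-identityʳ t ⟩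
      t                        ∎)
      where
      open import Relation.Binary.Reasoning.Setoid ≋-setoid
      s = proj₁ sixteenth
      reassociate : ∀ t s → + 16 * (t * s) ≡ t * (+ 16 * s)
      reassociate = solve-∀

    U L : ℤ → M₂
    U x = mk 1ℤ x 0ℤ 1ℤ
    L y = mk 1ℤ 0ℤ y 1ℤ

    Us Ls : ℕ → Word
    Us n = replicate n (letter first upper pos)
    Ls n = replicate n (letter first lower pos)

    prod-Us : ∀ n → prod (Us n) ≡ U (+ 16 * + n)
    prod-Us zero    = refl
    prod-Us (suc n) =
      trans (cong (gen (letter first upper pos) ⊗_) (prod-Us n)) (mk-cong (e₁ (+ n)) (e₂ (+ n)) (e₃ (+ n)) (e₄ (+ n)))
      where
      e₁ : ∀ n → 1ℤ * 1ℤ + + 16 * 0ℤ ≡ 1ℤ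
      e₁ = solve-∀
      e₂ : ∀ n → 1ℤ * (+ 16 * n) + + 16 * 1ℤ ≡ + 16 * (1ℤ + n)
      e₂ = solve-∀
      e₃ : ∀ n → 0ℤ * 1ℤ + 1ℤ * 0ℤ ≡ 0ℤ
      e₃ = solve-∀
      e₄ : ∀ n → 0ℤ * (+ 16 * n) + 1ℤ * 1ℤ ≡ 1ℤ
      e₄ = solve-∀

    prod-Ls : ∀ n → prod (Ls n) ≡ L (+ 16 * + n)
    prod-Ls zero    = refl
    prod-Ls (suc n) =
      trans (cong (gen (letter first lower pos) ⊗_) (prod-Ls n)) (mk-cong (e₁ (+ n)) (e₂ (+ n)) (e₃ (+ n)) (e₄ (+ n)))
      where
      e₁ : ∀ n → 1ℤ * 1ℤ + 0ℤ * (+ 16 * n) ≡ 1ℤ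
      e₁ = solve-∀
      e₂ : ∀ n → 1ℤ * 0ℤ + 0ℤ * 1ℤ ≡ 0ℤ
      e₂ = solve-∀
      e₃ : ∀ n → + 16 * 1ℤ + 1ℤ * (+ 16 * n) ≡ + 16 * (1ℤ + n)
      e₃ = solve-∀
      e₄ : ∀ n → + 16 * 0ℤ + 1ℤ * 1ℤ ≡ 1ℤ
      e₄ = solve-∀

    ULU : ∀ x y z → U x ⊗ L y ⊗ U z ≡ mk (1ℤ + x * y) ((1ℤ + x * y) * z + x) y (y * z + 1ℤ)
    ULU x y z = mk-cong (e₁ x y z) (e₂ x y z) (e₃ x y z) (e₄ x y z)
      where
      e₁ : ∀ x y z → (1ℤ * 1ℤ + x * y) * 1ℤ + (1ℤ * 0ℤ + x * 1ℤ) * 0ℤ ≡ 1ℤ + x * y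
      e₁ = solve-∀
      e₂ : ∀ x y z → (1ℤ * 1ℤ + x * y) * z + (1ℤ * 0ℤ + x * 1ℤ) * 1ℤ ≡ (1ℤ + x * y) * z + x
      e₂ = solve-∀
      e₃ : ∀ x y z → (0ℤ * 1ℤ + 1ℤ * y) * 1ℤ + (0ℤ * 0ℤ + 1ℤ * 1ℤ) * 0ℤ ≡ y
      e₃ = solve-∀
      e₄ : ∀ x y z → (0ℤ * 1ℤ + 1ℤ * y) * z + (0ℤ * 0ℤ + 1ℤ * 1ℤ) * 1ℤ ≡ y * z + 1ℤ
      e₄ = solve-∀

    ULU-cong : ∀ {x x′ y y′ z z′} → x ≋ x′ → y ≋ y′ → z ≋ z′ →
               U x ⊗ L y ⊗ U z ≋ᴹ U x′ ⊗ L y′ ⊗ U z′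
    ULU-cong {x} {x′} {y} {y′} {z} {z′} x≋x′ y≋y′ z≋z′ =
      ⊗-cong {U x ⊗ L y} {U x′ ⊗ L y′} {U z} {U z′}
        (⊗-cong {U x} {U x′} {L y} {L y′} (mk≋ ≋-refl x≋x′ ≋-refl ≋-refl) (mk≋ ≋-refl ≋-refl y≋y′ ≋-refl))
        (mk≋ ≋-refl z≋z′ ≋-refl ≋-refl)

    absorb : ∀ t c {g} → g ≋ 0ℤ → t + c * g ≋ t
    absorb t c g≋0 = ≋-trans (+-cong (≋-refl {t}) (*-cong (≋-refl {c}) g≋0)) (≡⇒≋ (identity t c))
      where
      identity : ∀ t c → t + c * 0ℤ ≡ t
      identity = solve-∀

    -- Bruhat: mk α β γ δ = U x ⊗ L γ ⊗ U z for x = (α - 1)/γ and z = (δ - 1)/γ.  Each entry of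
    -- the left side differs from the right one by multiples of γ i - 1 and of det - 1.
    ULU-≋ : ∀ α β γ δ i → γ * i ≋ 1ℤ → α * δ - β * γ ≋ 1ℤ →
            U ((α - 1ℤ) * i) ⊗ L γ ⊗ U ((δ - 1ℤ) * i) ≋ᴹ mk α β γ δ
    ULU-≋ α β γ δ i γi≋1 det≋1 = ≋ᴹ-trans (≡⇒≋ᴹ (ULU ((α - 1ℤ) * i) γ ((δ - 1ℤ) * i))) (mk≋
      (≋-trans (≡⇒≋ (a-entry α γ δ i)) (absorb α (α - 1ℤ) g₁))
      (≋-trans (≡⇒≋ (b-entry α β γ δ i))
        (≋-trans (absorb (β + A * (γ * i - 1ℤ) + i * (α * δ - β * γ - 1ℤ)) β g₁)
        (≋-trans (absorb (β + A * (γ * i - 1ℤ)) i g₂) (absorb β A g₁))))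
      ≋-refl
      (≋-trans (≡⇒≋ (d-entry α γ δ i)) (absorb δ (δ - 1ℤ) g₁)))
      where
      A = (α - 1ℤ) * (δ - 1ℤ) * i
      g₁ : γ * i - 1ℤ ≋ 0ℤ
      g₁ = sub-cong γi≋1 (≋-refl {1ℤ})
      g₂ : α * δ - β * γ - 1ℤ ≋ 0ℤ
      g₂ = sub-cong det≋1 (≋-refl {1ℤ})
      a-entry : ∀ α γ δ i → 1ℤ + (α - 1ℤ) * i * γ ≡ α + (α - 1ℤ) * (γ * i - 1ℤ)
      a-entry = solve-∀
      b-entry : ∀ α β γ δ i →
                (1ℤ + (α - 1ℤ) * i * γ) * ((δ - 1ℤ) * i) + (α - 1ℤ) * i
                ≡ β + (α - 1ℤ) * (δ - 1ℤ) * i * (γ * i - 1ℤ) + i * (α * δ - β * γ - 1ℤ) + β * (γ * i - 1ℤ)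
      b-entry = solve-∀
      d-entry : ∀ α γ δ i → γ * ((δ - 1ℤ) * i) + 1ℤ ≡ δ + (δ - 1ℤ) * (γ * i - 1ℤ)
      d-entry = solve-∀

    K : ℕ
    K = suc (p ℕ.+ (p ℕ.+ p))

    Spans : Half → M₂ → Set
    Spans h M = ∃[ w ] (All (λ ℓ → half ℓ ≡ h) w × length w ℕ.≤ K × prod w ≋ᴹ M)

    spans-γ≉0 : ∀ α β γ δ → α * δ - β * γ ≋ 1ℤ → ¬ γ ≋ 0ℤ →
                ∃[ w ] (All (λ ℓ → half ℓ ≡ first) w × length w ℕ.≤ p ℕ.+ (p ℕ.+ p) × prod w ≋ᴹ mk α β γ δ)
    spans-γ≉0 α β γ δ det≋1 γ≉0 = Us a ++ (Ls b ++ Us c) , halves , length≤ , (begin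
      prod (Us a ++ (Ls b ++ Us c))                       ≡⟨ prod-++ (Us a) _ ⟩
      prod (Us a) ⊗ prod (Ls b ++ Us c)                   ≡⟨ cong (prod (Us a) ⊗_) (prod-++ (Ls b) (Us c)) ⟩
      prod (Us a) ⊗ (prod (Ls b) ⊗ prod (Us c))           ≡⟨ ⊗-assoc (prod (Us a)) (prod (Ls b)) (prod (Us c)) ⟨
      prod (Us a) ⊗ prod (Ls b) ⊗ prod (Us c)             ≡⟨ cong₂ _⊗_ (cong₂ _⊗_ (prod-Us a) (prod-Ls b)) (prod-Us c) ⟩
      U (+ 16 * + a) ⊗ L (+ 16 * + b) ⊗ U (+ 16 * + c)    ≈⟨ ULU-cong 16a≋x 16b≋γ 16c≋z ⟩
      U ((α - 1ℤ) * γ⁻¹) ⊗ L γ ⊗ U ((δ - 1ℤ) * γ⁻¹)       ≈⟨ ULU-≋ α β γ δ γ⁻¹ (proj₂ (inverse γ γ≉0)) det≋1 ⟩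
      mk α β γ δ                                          ∎)
      where
      open import Relation.Binary.Reasoning.Setoid ≋ᴹ-setoid
      γ⁻¹ = proj₁ (inverse γ γ≉0)
      Mx = multiple-of-16 ((α - 1ℤ) * γ⁻¹)
      My = multiple-of-16 γ
      Mz = multiple-of-16 ((δ - 1ℤ) * γ⁻¹)
      a = proj₁ Mx
      b = proj₁ My
      c = proj₁ Mz
      16a≋x = proj₂ (proj₂ Mx)
      16b≋γ = proj₂ (proj₂ My)
      16c≋z = proj₂ (proj₂ Mz)
      halves : All (λ ℓ → half ℓ ≡ first) (Us a ++ (Ls b ++ Us c))
      halves = ++⁺ (replicate⁺ a refl) (++⁺ (replicate⁺ b refl) (replicate⁺ c refl))
      length-word : length (Us a ++ (Ls b ++ Us c)) ≡ a ℕ.+ (b ℕ.+ c)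
      length-word = trans (length-++ (Us a)) (cong₂ ℕ._+_ (length-replicate a)
                      (trans (length-++ (Ls b)) (cong₂ ℕ._+_ (length-replicate b) (length-replicate c))))
      length≤ : length (Us a ++ (Ls b ++ Us c)) ℕ.≤ p ℕ.+ (p ℕ.+ p)
      length≤ = subst (ℕ._≤ p ℕ.+ (p ℕ.+ p)) (sym length-word)
        (ℕ.+-mono-≤ (ℕ.<⇒≤ (proj₁ (proj₂ Mx))) (ℕ.+-mono-≤ (ℕ.<⇒≤ (proj₁ (proj₂ My))) (ℕ.<⇒≤ (proj₁ (proj₂ Mz)))))

    -- If γ ≡ 0 then δ ≢ 0, and M ⊗ B, with lower-left entry 16δ ≢ 0, is factored instead.
    spans-first : ∀ M → det M ≋ 1ℤ → Spans first M
    spans-first (mk α β γ δ) det≋1 with γ ≋0?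
    ... | no γ≉0 = let (w , halves , length≤ , w≋M) = spans-γ≉0 α β γ δ det≋1 γ≉0 in
                   w , halves , ℕ.m≤n⇒m≤1+n length≤ , w≋M
    ... | yes γ≋0 = w ++ ℓ ⁻¹ ∷ [] , ++⁺ halves (refl ∷ []) , length≤′ , (begin
      prod (w ++ ℓ ⁻¹ ∷ [])           ≡⟨ prod-++ w (ℓ ⁻¹ ∷ []) ⟩
      prod w ⊗ (gen (ℓ ⁻¹) ⊗ 𝟙)       ≈⟨ ⊗-cong {prod w} {M ⊗ gen ℓ} {gen (ℓ ⁻¹) ⊗ 𝟙} w≋Mℓ ≋ᴹ-refl ⟩
      M ⊗ gen ℓ ⊗ (gen (ℓ ⁻¹) ⊗ 𝟙)    ≡⟨ cong (M ⊗ gen ℓ ⊗_) (⊗-identityʳ (gen (ℓ ⁻¹))) ⟩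
      M ⊗ gen ℓ ⊗ gen (ℓ ⁻¹)          ≡⟨ ⊗-assoc M (gen ℓ) (gen (ℓ ⁻¹)) ⟩
      M ⊗ (gen ℓ ⊗ gen (ℓ ⁻¹))        ≡⟨ cong (M ⊗_) (gen-⁻¹ ℓ) ⟩
      M ⊗ 𝟙                           ≡⟨ ⊗-identityʳ M ⟩
      M                               ∎)
      where
      open import Relation.Binary.Reasoning.Setoid ≋ᴹ-setoid
      M = mk α β γ δ
      ℓ = letter first lower pos
      δ≉0 : ¬ δ ≋ 0ℤ
      δ≉0 δ≋0 = 0≉1 (≋-trans (≡⇒≋ (vanish α β))
        (≋-trans (sub-cong (*-cong (≋-refl {α}) (≋-sym δ≋0)) (*-cong (≋-refl {β}) (≋-sym γ≋0))) det≋1))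
        where
        vanish : ∀ α β → 0ℤ ≡ α * 0ℤ - β * 0ℤ
        vanish = solve-∀
      γ′≉0 : ¬ γ * 1ℤ + δ * + 16 ≋ 0ℤ
      γ′≉0 γ′≋0 = *-≉0 δ≉0 (small-≉0 16<p (λ ())) (≋-trans (≡⇒≋ (drop γ δ))
        (≋-trans (+-cong (*-cong (≋-sym γ≋0) (≋-refl {1ℤ})) (≋-refl {δ * + 16})) γ′≋0))
        where
        drop : ∀ γ δ → δ * + 16 ≡ 0ℤ * 1ℤ + δ * + 16
        drop = solve-∀
      det′≋1 : det (M ⊗ gen ℓ) ≋ 1ℤ
      det′≋1 = ≋-trans (≡⇒≋ (trans (det-⊗ M (gen ℓ)) (cong (det M *_) (det-gen ℓ))))
                       (*-cong det≋1 (≋-refl {1ℤ}))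
      spans′ = spans-γ≉0 _ _ _ _ det′≋1 γ′≉0
      w = proj₁ spans′
      halves = proj₁ (proj₂ spans′)
      w≋Mℓ = proj₂ (proj₂ (proj₂ spans′))
      length≤′ : length (w ++ ℓ ⁻¹ ∷ []) ℕ.≤ K
      length≤′ = subst (ℕ._≤ K) (sym (trans (length-++ w) (ℕ.+-comm (length w) 1)))
                       (s≤s (proj₁ (proj₂ (proj₂ spans′))))

    second-half : Letter → Letter
    second-half (letter _ s σ) = letter second s σ

    𝕙-conj-word : ∀ w → All (λ ℓ → half ℓ ≡ first) w → 𝕙 ⊗ prod w ≡ prod (map second-half w) ⊗ 𝕙
    𝕙-conj-word [] [] = trans (⊗-identityʳ 𝕙) (sym (⊗-identityˡ 𝕙))
    𝕙-conj-word (letter first s σ ∷ w) (refl ∷ halves) = begin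
      𝕙 ⊗ (gen (letter first s σ) ⊗ prod w)                      ≡⟨ ⊗-assoc 𝕙 _ (prod w) ⟨
      𝕙 ⊗ gen (letter first s σ) ⊗ prod w                        ≡⟨ cong (_⊗ prod w) (𝕙-conj s σ) ⟩
      gen (letter second s σ) ⊗ 𝕙 ⊗ prod w                       ≡⟨ ⊗-assoc (gen (letter second s σ)) 𝕙 (prod w) ⟩
      gen (letter second s σ) ⊗ (𝕙 ⊗ prod w)                     ≡⟨ cong (gen (letter second s σ) ⊗_) (𝕙-conj-word w halves) ⟩
      gen (letter second s σ) ⊗ (prod (map second-half w) ⊗ 𝕙)   ≡⟨ ⊗-assoc (gen (letter second s σ)) _ 𝕙 ⟨
      prod (map second-half (letter first s σ ∷ w)) ⊗ 𝕙          ∎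
      where open ≡-Reasoning

    second-half-halves : ∀ w → All (λ ℓ → half ℓ ≡ second) (map second-half w)
    second-half-halves []      = []
    second-half-halves (_ ∷ w) = refl ∷ second-half-halves w

    halving : ∃[ i ] + 2 * i ≋ 1ℤ
    halving = inverse (+ 2) (small-≉0 (ℕ.<-trans (s≤s (s≤s (s≤s z≤n))) 16<p) (λ ()))

    𝕙⁻¹ : M₂
    𝕙⁻¹ = mk i i (- i) i
      where i = proj₁ halving

    𝕙⊗𝕙⁻¹ : 𝕙 ⊗ 𝕙⁻¹ ≋ᴹ 𝟙
    𝕙⊗𝕙⁻¹ =
      mk≋ (≋-trans (≡⇒≋ (e₁ i)) (proj₂ halving)) (≡⇒≋ (e₂ i)) (≡⇒≋ (e₃ i)) (≋-trans (≡⇒≋ (e₄ i)) (proj₂ halving))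
      where
      i = proj₁ halving
      e₁ : ∀ i → 1ℤ * i + - 1ℤ * - i ≡ + 2 * i
      e₁ = solve-∀
      e₂ : ∀ i → 1ℤ * i + - 1ℤ * i ≡ 0ℤ
      e₂ = solve-∀
      e₃ : ∀ i → 1ℤ * i + 1ℤ * - i ≡ 0ℤ
      e₃ = solve-∀
      e₄ : ∀ i → 1ℤ * i + 1ℤ * i ≡ + 2 * i
      e₄ = solve-∀

    det-𝕙⁻¹⊗𝕙 : det 𝕙⁻¹ * det 𝕙 ≋ 1ℤ
    det-𝕙⁻¹⊗𝕙 = ≋-trans (≡⇒≋ (squares (proj₁ halving))) (*-cong (proj₂ halving) (proj₂ halving))
      where
      squares : ∀ i → (i * i - i * - i) * (1ℤ * 1ℤ - - 1ℤ * 1ℤ) ≡ (+ 2 * i) * (+ 2 * i)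
      squares = solve-∀

    ⊗-cancelʳ-𝕙 : ∀ {X Y} → X ⊗ 𝕙 ≋ᴹ Y ⊗ 𝕙 → X ≋ᴹ Y
    ⊗-cancelʳ-𝕙 {X} {Y} X𝕙≋Y𝕙 = begin
      X                 ≡⟨ ⊗-identityʳ X ⟨
      X ⊗ 𝟙             ≈⟨ ⊗-cong {X} {X} {𝕙 ⊗ 𝕙⁻¹} {𝟙} ≋ᴹ-refl 𝕙⊗𝕙⁻¹ ⟨
      X ⊗ (𝕙 ⊗ 𝕙⁻¹)     ≡⟨ ⊗-assoc X 𝕙 𝕙⁻¹ ⟨
      X ⊗ 𝕙 ⊗ 𝕙⁻¹       ≈⟨ ⊗-cong {X ⊗ 𝕙} {Y ⊗ 𝕙} {𝕙⁻¹} {𝕙⁻¹} X𝕙≋Y𝕙 ≋ᴹ-refl ⟩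
      Y ⊗ 𝕙 ⊗ 𝕙⁻¹       ≡⟨ ⊗-assoc Y 𝕙 𝕙⁻¹ ⟩
      Y ⊗ (𝕙 ⊗ 𝕙⁻¹)     ≈⟨ ⊗-cong {Y} {Y} {𝕙 ⊗ 𝕙⁻¹} {𝟙} ≋ᴹ-refl 𝕙⊗𝕙⁻¹ ⟩
      Y ⊗ 𝟙             ≡⟨ ⊗-identityʳ Y ⟩
      Y                 ∎
      where open import Relation.Binary.Reasoning.Setoid ≋ᴹ-setoid

    spans-second : ∀ M → det M ≋ 1ℤ → Spans second M
    spans-second M det≋1 =
      map second-half w , second-half-halves w , subst (ℕ._≤ K) (sym (length-map second-half w)) length≤ ,
      ⊗-cancelʳ-𝕙 (begin
        prod (map second-half w) ⊗ 𝕙      ≡⟨ 𝕙-conj-word w halves ⟨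
        𝕙 ⊗ prod w                        ≈⟨ ⊗-cong {𝕙} {𝕙} {prod w} {𝕙⁻¹ ⊗ (M ⊗ 𝕙)} ≋ᴹ-refl w≋ ⟩
        𝕙 ⊗ (𝕙⁻¹ ⊗ (M ⊗ 𝕙))               ≡⟨ ⊗-assoc 𝕙 𝕙⁻¹ (M ⊗ 𝕙) ⟨
        𝕙 ⊗ 𝕙⁻¹ ⊗ (M ⊗ 𝕙)                 ≈⟨ ⊗-cong {𝕙 ⊗ 𝕙⁻¹} {𝟙} {M ⊗ 𝕙} {M ⊗ 𝕙} 𝕙⊗𝕙⁻¹ ≋ᴹ-refl ⟩
        𝟙 ⊗ (M ⊗ 𝕙)                       ≡⟨ ⊗-identityˡ (M ⊗ 𝕙) ⟩
        M ⊗ 𝕙                             ∎)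
      where
      open import Relation.Binary.Reasoning.Setoid ≋ᴹ-setoid
      det′≋1 : det (𝕙⁻¹ ⊗ (M ⊗ 𝕙)) ≋ 1ℤ
      det′≋1 = ≋-trans (≡⇒≋ (trans (det-⊗ 𝕙⁻¹ (M ⊗ 𝕙)) (cong (det 𝕙⁻¹ *_) (det-⊗ M 𝕙))))
               (≋-trans (*-cong (≋-refl {det 𝕙⁻¹}) (*-cong det≋1 (≋-refl {det 𝕙})))
               (≋-trans (≡⇒≋ (cong (det 𝕙⁻¹ *_) (ℤ.*-identityˡ (det 𝕙)))) det-𝕙⁻¹⊗𝕙))
      spans′ = spans-first (𝕙⁻¹ ⊗ (M ⊗ 𝕙)) det′≋1
      w = proj₁ spans′
      halves = proj₁ (proj₂ spans′)
      length≤ = proj₁ (proj₂ (proj₂ spans′))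
      w≋ = proj₂ (proj₂ (proj₂ spans′))

    spans : ∀ h M → det M ≋ 1ℤ → Spans h M
    spans first  = spans-first
    spans second = spans-second

module Primes where
  open import Data.Nat as ℕ using (suc; _!)
  import Data.Nat.Properties as ℕ
  open import Data.Nat.Divisibility using (_∣_; ∣-trans; m∣m*n; ∣1⇒≡1; ∣m+n∣m⇒∣n; m≤n⇒m!∣n!)
  open import Data.Nat.Primality using (Prime; prime⇒nonZero; prime⇒nonTrivial)
  open import Data.Nat.Primality.Factorisation using (factorise; PrimeFactorisation)
  open import Data.Nat.ListAction using (product)
  open import Data.List using ([]; _∷_)
  open import Data.List.Relation.Unary.All using (All; _∷_)
  open import Data.Product using (_,_)
  open import Relation.Nullary using (¬_; contradiction)
  open import Relation.Binary.PropositionalEquality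

  ∣-! : ∀ {m n} → 0 ℕ.< m → m ℕ.≤ n → m ∣ n !
  ∣-! {suc m} _ m≤n = ∣-trans (m∣m*n (m !)) (m≤n⇒m!∣n! m≤n)

  prime-above : ∀ n → ∃[ q ] (Prime q × n ℕ.< q)
  prime-above n = first-factor factors isFactorisation factorsPrime
    where
    open PrimeFactorisation (factorise (1 ℕ.+ n !))
    first-factor : ∀ qs → 1 ℕ.+ n ! ≡ product qs → All Prime qs → ∃[ q ] (Prime q × n ℕ.< q)
    first-factor []       1+n!≡1 _ = contradiction (sym (ℕ.suc-injective 1+n!≡1)) (ℕ.<⇒≢ (ℕ.1≤n! n))
    first-factor (q ∷ qs) 1+n!≡ (prime-q ∷ _) = q , prime-q , ℕ.≰⇒> q≰n
      where
      q∣n!+1 : q ∣ n ! ℕ.+ 1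
      q∣n!+1 = subst (q ∣_) (trans (sym 1+n!≡) (ℕ.+-comm 1 (n !))) (m∣m*n (product qs))
      q≰n : ¬ q ℕ.≤ n
      q≰n q≤n = ℕ.nonTrivial⇒≢1 {{prime⇒nonTrivial prime-q}}
        (∣1⇒≡1 (∣m+n∣m⇒∣n q∣n!+1 (∣-! (ℕ.>-nonZero⁻¹ q {{prime⇒nonZero prime-q}}) q≤n)))

module Construction (g : ℕ) (3≤g : 3 ≤ g) (p : ℕ) (prime : Prime p) (big : 17 ℕ.^ g ℕ.* 2 ℕ.+ 2 ℕ.< p) where
  open import Data.Nat using (_^_; _<_; z≤n; s≤s)
  open import Data.Nat.Properties
  open import Data.List using (length; foldl)
  open import Data.List.Relation.Unary.All using (All)
  open import Data.Product using (_,_)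
  open import Relation.Binary.PropositionalEquality
  open TemporalLabelling
  open CayleyGraphs
  open IntegerMatrices
  open Congruences

  instance
    p≢0 : NonZero p
    p≢0 = prime⇒nonZero prime

  16<p : 16 < p
  16<p = <⇒≤ (≤-<-trans (≤-trans (^-monoʳ-≤ 17 (≤-trans (s≤s z≤n) 3≤g))
                                 (≤-trans (m≤m*n (17 ^ g) 2) (m≤m+n _ 2))) big)

  open Modular p
  open SpecialLinear p (≤-<-trans (s≤s z≤n) 16<p)
  open Generation p prime 16<p

  short-free : ∀ v w → Reduced w → 0 < length w → length w < g → foldl _·_ v w ≢ v
  short-free v w reduced nonempty short fixed =
    relator-free w reduced nonempty
      (≤-<-trans (+-monoˡ-≤ 2 (*-monoˡ-≤ 2 (^-monoʳ-≤ 17 (<⇒≤ short)))) big)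
      (fixed⇒relator v w fixed)

  open Cayley _·_ ·-⁻¹ g 3≤g short-free

  -- Written without `with`: abstracting the Spans term in the goal exhausts memory.
  spans-root : ∀ h v → ∃[ w ] (All (λ ℓ → Letter.half ℓ ≡ h) w × length w ≤ K × foldl _·_ root w ≡ v)
  spans-root h v = reach (spans h (matrix v) (det-matrix v))
    where
    reach : Spans h (matrix v) →
            ∃[ w ] (All (λ ℓ → Letter.half ℓ ≡ h) w × length w ≤ K × foldl _·_ root w ≡ v)
    reach (w , halves , length≤ , w≋v) = w , halves , length≤ , root-·ʷ v w w≋v

  open HalfTrees root K spans-root
  open TwoTreeLabelling graph root K (tree first) (tree second) trees-disjoint

  result : ∃[ T ] (Happy T × TemporallyConnected T × GirthAtLeast (G T) g)
  result = temporalGraph , happy , connected , Orbit.cycle root (letter first upper pos) , cycle-length-≥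

theorem6 : ∀ (g : ℕ) → 4 ≤ g →
    ∃[ T ] (Happy T × TemporallyConnected T × GirthAtLeast (G T) g)
theorem6 g 4≤g with Primes.prime-above (17 ℕ.^ g ℕ.* 2 ℕ.+ 2)
... | p , p-prime , big = Construction.result g (ℕ.≤-trans (ℕ.n≤1+n 3) 4≤g) p p-prime big
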